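{- Let $\mathcal T$ be a finite rooted tree with at least one edge, whose nodes are labelled by pairwise distinct letters. Then the set of constructions of the hypergraph $\mathbb G(\mathcal T)$ is in bijection with the set of fully parenthesised words that are admissible for $\mathcal T$.
   Context: Hypergraphs: a hypergraph on a finite set $H$ is a set $\mathbf H\subseteq\mathcal P(H)\setminus\{\emptyset\}$ with $\bigcup\mathbf H=H$; atomic if it contains all singletons. $\mathbf H_X=\{Z\in\mathbf H:Z\subseteq X\}$; $\mathbf H$ is connected if there is no partition of $H$ into two non-empty disjoint $X_1,X_2$ with $\mathbf H=\mathbf H_{X_1}\cup\mathbf H_{X_2}$; $\mathbf H,X\leadsto H_1,\dots,H_n$ means $H_1,\dots,H_n$ are the connected components of $\mathbf H_{H\setminus X}$, and $\mathbf H_i=\mathbf H_{H_i}$. Constructs of a connected $\mathbf H$: for non-empty $Y\subseteq H$, if $Y=H$ the one-node tree labelled $H$ is a construct; otherwise if $\mathbf H,Y\leadsto H_1,\dots,H_n$ and $T_i$ are constructs of $\mathbf H_i$, the rooted tree $Y(T_1,\dots,T_n)$ (root labelled $Y$, unordered subtrees $T_i$) is a construct. A construction is a construct all of whose labels are singletons. $\mathbb G(\mathcal T)$: the graph whose vertices are the edges of $\mathcal T$, two vertices being adjacent iff, as edges of $\mathcal T$, they share a node; it is regarded as the atomic hypergraph consisting of all singletons of vertices and all pairs of adjacent vertices (it is connected). Fully parenthesised words over the letters of $\mathcal T$: $w::=a\mid(ww)$, $a$ a letter. For a tree $\mathcal S$ whose nodes are distinct letters: a letter $a$ is admissible for the one-node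 tree $a$; $(w_1w_2)$ is admissible for $\mathcal S$ if there is an edge $x$ of $\mathcal S$ such that, after deleting $x$, $w_1$ is admissible for the component containing the root of $\mathcal S$ and $w_2$ is admissible for the other component (the subtree rooted at the child endpoint of $x$). -}

module Defs where

open import Data.Bool using (Bool; true; false; _∧_; not)
open import Data.Product using (Σ; Σ-syntax; ∃; _×_; _,_; proj₁; proj₂)
open import Data.Sum using (_⊎_)
open import Data.List using (List; []; _∷_; _++_)
open import Data.List.Relation.Unary.All using (All)
open import Data.List.Relation.Unary.Any using (Any)
open import Data.List.Relation.Unary.AllPairs using (AllPairs)
open import Data.List.Relation.Binary.Pointwise using (Pointwise)
open import Data.List.Relation.Binary.Permutation.Homogeneous using (Permutation)
open import Data.List.Membership.Propositional using (_∈_)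
open import Relation.Nullary using (¬_)
open import Data.Empty using (⊥)
open import Relation.Binary.PropositionalEquality using (_≡_; _≢_)

Sub : Set → Set
Sub V = V → Bool

module _ {V : Set} where

  _∈ₛ_ : V → Sub V → Set
  v ∈ₛ Y = Y v ≡ true

  _⊆ₛ_ : Sub V → Sub V → Set
  X ⊆ₛ Y = ∀ v → v ∈ₛ X → v ∈ₛ Y

  _≐_ : Sub V → Sub V → Set
  X ≐ Y = ∀ v → X v ≡ Y v

  _∖_ : Sub V → Sub V → Sub V
  (X ∖ Y) v = X v ∧ not (Y v)

  NonEmpty : Sub V → Set
  NonEmpty X = ∃ λ v → v ∈ₛ X

  Disjoint : Sub V → Sub V → Set
  Disjoint X Y = ∀ v → v ∈ₛ X → v ∈ₛ Y → ⊥

  IsSingletonOf : Sub V → V → Set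
  IsSingletonOf Z e = ∀ v → (v ∈ₛ Z → v ≡ e) × (v ≡ e → v ∈ₛ Z)

  IsSingleton : Sub V → Set
  IsSingleton Z = ∃ λ e → IsSingletonOf Z e

  IsPairOf : Sub V → V → V → Set
  IsPairOf Z e e' = ∀ v → (v ∈ₛ Z → v ≡ e ⊎ v ≡ e') × (v ≡ e ⊎ v ≡ e' → v ∈ₛ Z)

-- A hypergraph is given by a family E of hyperedges
-- (subsets of V).  For a subset S, "E on S" denotes the restricted
-- hypergraph E_S = {Z ∈ E : Z ⊆ S} with underlying set S.
-- All hypergraphs occurring in the definition of constructs are
-- restrictions of one fixed hypergraph, so we carry (E , S).

module _ {V : Set} (E : Sub V → Set) where

  Connected : Sub V → Set
  Connected S =
    ∀ (X₁ X₂ : Sub V) →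
      ¬ ( NonEmpty X₁ × NonEmpty X₂ × Disjoint X₁ X₂
        × X₁ ⊆ₛ S × X₂ ⊆ₛ S × (∀ v → v ∈ₛ S → v ∈ₛ X₁ ⊎ v ∈ₛ X₂)
        × (∀ Z → E Z → Z ⊆ₛ S → Z ⊆ₛ X₁ ⊎ Z ⊆ₛ X₂) )

  Components : Sub V → List (Sub V) → Set
  Components S Hs =
      All (λ H → NonEmpty H × H ⊆ₛ S × Connected H) Hs
    × AllPairs Disjoint Hs
    × (∀ v → v ∈ₛ S → Any (λ H → v ∈ₛ H) Hs)
    × (∀ Z → E Z → Z ⊆ₛ S → Any (λ H → Z ⊆ₛ H) Hs)

-- Rooted trees labelled by subsets (constructs).  Children are stored in
-- a list, but trees are compared up to permutation of children
-- (relation _≈T_), i.e. subtrees are unordered.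

data CTree (V : Set) : Set where
  node : Sub V → List (CTree V) → CTree V

data _≈T_ {V : Set} : CTree V → CTree V → Set where
  node≈ : ∀ {Y Y' ts ts'} → Y ≐ Y' → Permutation _≈T_ ts ts' →
          node Y ts ≈T node Y' ts'

module _ {V : Set} (E : Sub V → Set) where

  data IsConstruct : Sub V → CTree V → Set where
    top  : ∀ {S Y} → NonEmpty Y → Y ≐ S → IsConstruct S (node Y [])
    step : ∀ {S Y} (Hs : List (Sub V)) {ts : List (CTree V)} →
           NonEmpty Y → Y ⊆ₛ S → ¬ (Y ≐ S) →
           Components E (S ∖ Y) Hs →
           Pointwise IsConstruct Hs ts →
           IsConstruct S (node Y ts)

data AllSingletons {V : Set} : CTree V → Set where
  node : ∀ {Y ts} → IsSingleton Y → All AllSingletons ts → AllSingletons (node Y ts)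

IsConstruction : {V : Set} → (Sub V → Set) → Sub V → CTree V → Set
IsConstruction E S t = IsConstruct E S t × AllSingletons t

full : {V : Set} → Sub V
full _ = true

data RTree (A : Set) : Set where
  nd : A → List (RTree A) → RTree A

rootLabel : {A : Set} → RTree A → A
rootLabel (nd a _) = a

children : {A : Set} → RTree A → List (RTree A)
children (nd _ ts) = ts

mutual
  labels : {A : Set} → RTree A → List A
  labels (nd a ts) = a ∷ labelsF ts

  labelsF : {A : Set} → List (RTree A) → List A
  labelsF []       = []
  labelsF (t ∷ ts) = labels t ++ labelsF ts

data ChildOf {A : Set} : RTree A → A → A → Set where
  direct : ∀ {a ts t} → t ∈ ts → ChildOf (nd a ts) a (rootLabel t)
  deep   : ∀ {c ts t x y} → t ∈ ts → ChildOf t x y → ChildOf (nd c ts) x y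

-- Edges of T (an edge is determined by its two endpoints, which are
-- identified by their (pairwise distinct) letters).
Edge : {A : Set} → RTree A → Set
Edge {A} T = Σ (A × A) λ p → ChildOf T (proj₁ p) (proj₂ p)

ShareNode : {A : Set} {T : RTree A} → Edge T → Edge T → Set
ShareNode ((a , b) , _) ((c , d) , _) = a ≡ c ⊎ a ≡ d ⊎ b ≡ c ⊎ b ≡ d

𝔾 : {A : Set} (T : RTree A) → Sub (Edge T) → Set
𝔾 T Z = (∃ λ e → IsSingletonOf Z e)
       ⊎ (Σ[ e ∈ Edge T ] Σ[ e' ∈ Edge T ] (e ≢ e' × ShareNode e e' × IsPairOf Z e e'))

data Word (A : Set) : Set where
  ltr : A → Word A
  ⟨_·_⟩ : Word A → Word A → Word A

-- Split S S₁ S₂ : deleting some edge x of S leaves the component S₁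
-- containing the root of S and the subtree S₂ rooted at the child
-- endpoint of x.
data Split {A : Set} : RTree A → RTree A → RTree A → Set where
  cut  : ∀ {a t} (ts₁ ts₂ : List (RTree A)) →
         Split (nd a (ts₁ ++ t ∷ ts₂)) (nd a (ts₁ ++ ts₂)) t
  down : ∀ {a t t₁ s} (ts₁ ts₂ : List (RTree A)) → Split t t₁ s →
         Split (nd a (ts₁ ++ t ∷ ts₂)) (nd a (ts₁ ++ t₁ ∷ ts₂)) s

data Admissible {A : Set} : Word A → RTree A → Set where
  letter : ∀ {a} → Admissible (ltr a) (nd a [])
  split  : ∀ {S S₁ S₂ w₁ w₂} → Split S S₁ S₂ →
           Admissible w₁ S₁ → Admissible w₂ S₂ → Admissible ⟨ w₁ · w₂ ⟩ S

Construction : {A : Set} (T : RTree A) → Set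
Construction T = Σ (CTree (Edge T)) (IsConstruction (𝔾 T) full)

_≈C_ : {A : Set} {T : RTree A} → Construction T → Construction T → Set
c ≈C c' = proj₁ c ≈T proj₁ c'

record BijectionOnto {X Y : Set} (_≈_ : X → X → Set) (P : Y → Set) : Set where
  field
    f         : X → Y
    into      : ∀ x → P (f x)
    respects  : ∀ x x' → x ≈ x' → f x ≡ f x'
    injective : ∀ x x' → f x ≡ f x' → x ≈ x'
    onto      : ∀ y → P y → Σ[ x ∈ X ] f x ≡ y

module Submission where

-- The argument works with pieces: a subtree S of T together with its edge set σ.
-- A construction of σ has a root {x}, x an edge of S; deleting x splits S into the
-- part S₁ containing the root and the part S₂ below x.  The edge sets σ₁, σ₂ of the
-- parts are connected and separate σ ∖ {x}, so the components of σ ∖ {x} are exactly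
-- the non-empty ones among them, and the children of the construction are one
-- construction of each part that has an edge ("Shape").  The word of a construction
-- is ⟨ upper word · lower word ⟩, the word of a part without edges being its node;
-- the lower word is recognised as the one starting at the lower endpoint of x.  This
-- mirrors the definition of admissibility, and induction over constructions shows
-- that the word is admissible, that every admissible word arises, that equal words
-- come from equivalent constructions, and that equivalent constructions have equal
-- words.

open import Defs
open import Data.List using ([])
open import Data.List.Relation.Unary.Unique.Propositional using (Unique)
open import Relation.Binary.PropositionalEquality using (_≢_)

open import Data.Bool using (Bool; true; false; _∧_; _∨_; not; if_then_else_)
open import Data.Bool.Properties using (∨-zeroʳ)
open import Data.Product using (Σ; _×_; _,_; proj₁; proj₂)
import Data.Product
open import Data.Sum using (_⊎_; inj₁; inj₂; [_,_]′)
import Data.Sum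
open import Data.List using (List; _∷_; _++_; map)
open import Data.List.Relation.Unary.All as All using (All; []; _∷_)
open import Data.List.Relation.Unary.Any as Any using (Any; here; there)
import Data.List.Relation.Unary.Any.Properties as AnyP
import Data.List.Relation.Unary.All.Properties as AllP
open import Data.List.Relation.Unary.AllPairs as APr using (AllPairs; []; _∷_)
import Data.List.Relation.Unary.AllPairs.Properties as APP
open import Data.List.Relation.Binary.Pointwise using (Pointwise; []; _∷_)
import Data.List.Relation.Binary.Pointwise as PWP
import Data.List.Relation.Binary.Permutation.Homogeneous as PH
open import Data.List.Membership.Propositional using (_∈_; find)
open import Data.List.Membership.Propositional.Properties
  using (∈-++⁺ˡ; ∈-++⁺ʳ; ∈-++⁻; ∈-insert; ∈-∃++)
open import Data.List.Relation.Binary.Permutation.Propositional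
  using (_↭_; ↭-refl; ↭-reflexive; ↭-sym; ↭-trans; prep; swap; ↭⇒↭ₛ; module PermutationReasoning)
import Data.List.Relation.Binary.Permutation.Propositional.Properties as ↭
open import Data.List.Properties using (++-assoc; ++-identityʳ; map-++)
open import Data.Empty using (⊥; ⊥-elim)
open import Data.Unit using (⊤; tt)
open import Relation.Nullary using (¬_; Dec; yes; no; does; map′)
open import Relation.Nullary.Decidable using (dec-true; dec-false)
open import Relation.Binary.PropositionalEquality
  using (_≡_; refl; sym; trans; cong; cong₂; subst; subst₂)
import Relation.Binary.PropositionalEquality as ≡

module Lists {X : Set} where

  open import Data.List.Relation.Binary.Permutation.Setoid.Properties (≡.setoid X)
    using (Unique-resp-↭)

  unique-++⁻ : ∀ (xs : List X) {ys} → Unique (xs ++ ys) →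
               Unique xs × Unique ys × (∀ {z} → z ∈ xs → z ∈ ys → ⊥)
  unique-++⁻ [] u = [] , u , λ ()
  unique-++⁻ (x ∷ xs) (x∉ ∷ u) with unique-++⁻ xs u
  ... | u₁ , u₂ , disjoint =
    All.tabulate (λ m → All.lookup x∉ (∈-++⁺ˡ m)) ∷ u₁ , u₂ ,
    λ { (here refl) m → All.lookup x∉ (∈-++⁺ʳ xs m) refl
      ; (there m) m′ → disjoint m m′ }

  unique-↭ : ∀ {xs ys : List X} → xs ↭ ys → Unique xs → Unique ys
  unique-↭ p = Unique-resp-↭ (↭⇒↭ₛ p)

  -- Equality is decidable between members of a duplicate-free list: compare positions.
  ≟-unique : ∀ {xs : List X} {a b} → Unique xs → a ∈ xs → b ∈ xs → Dec (a ≡ b)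
  ≟-unique u (here p) (here q) = yes (trans p (sym q))
  ≟-unique (x∉ ∷ u) (here p) (there q) =
    no λ a≡b → All.lookup x∉ (subst (_∈ _) (trans (sym a≡b) p) q) refl
  ≟-unique (x∉ ∷ u) (there p) (here q) =
    no λ a≡b → All.lookup x∉ (subst (_∈ _) (trans a≡b q) p) refl
  ≟-unique (_ ∷ u) (there p) (there q) = ≟-unique u p q

  ∈?-unique : ∀ {xs : List X} {a} → Unique xs → a ∈ xs →
              (ys : List X) → (∀ {y} → y ∈ ys → y ∈ xs) → Dec (a ∈ ys)
  ∈?-unique u a∈ [] ys⊆ = no λ ()
  ∈?-unique u a∈ (y ∷ ys) ys⊆ with ≟-unique u a∈ (ys⊆ (here refl))
  ... | yes a≡y = yes (here a≡y)
  ... | no a≢y = map′ there (λ { (here a≡y) → ⊥-elim (a≢y a≡y) ; (there m) → m })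
                      (∈?-unique u a∈ ys (λ m → ys⊆ (there m)))

  ∈-middle⁻ : ∀ xs {y ys} {z : X} → z ∈ xs ++ y ∷ ys → z ≡ y ⊎ z ∈ xs ++ ys
  ∈-middle⁻ [] (here z≡y) = inj₁ z≡y
  ∈-middle⁻ [] (there m) = inj₂ m
  ∈-middle⁻ (x ∷ xs) (here z≡x) = inj₂ (here z≡x)
  ∈-middle⁻ (x ∷ xs) (there m) with ∈-middle⁻ xs m
  ... | inj₁ z≡y = inj₁ z≡y
  ... | inj₂ m′ = inj₂ (there m′)

  ∈-middle⁺ : ∀ xs {y ys} {z : X} → z ∈ xs ++ ys → z ∈ xs ++ y ∷ ys
  ∈-middle⁺ xs m with ∈-++⁻ xs m
  ... | inj₁ m′ = ∈-++⁺ˡ m′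
  ... | inj₂ m′ = ∈-++⁺ʳ xs (there m′)

open Lists public

module _ {X : Set} {R : X → X → Set} (R-trans : ∀ {a b c} → R a b → R b c → R a c) where

  pointwise-member : ∀ {xs ys : List X} {x} → Pointwise R xs ys → x ∈ xs → Σ X λ y → y ∈ ys × R x y
  pointwise-member (r ∷ _) (here refl) = _ , here refl , r
  pointwise-member (_ ∷ pw) (there m) with pointwise-member pw m
  ... | y , m′ , r = y , there m′ , r

  related-member : ∀ {xs ys : List X} {x} → PH.Permutation R xs ys → x ∈ xs → Σ X λ y → y ∈ ys × R x y
  related-member (PH.refl pw) m = pointwise-member pw m
  related-member (PH.prep r _) (here refl) = _ , here refl , r
  related-member (PH.prep _ p) (there m) with related-member p m
  ... | y , m′ , r = y , there m′ , r
  related-member (PH.swap r₁ _ _) (here refl) = _ , there (here refl) , r₁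
  related-member (PH.swap _ r₂ _) (there (here refl)) = _ , here refl , r₂
  related-member (PH.swap _ _ p) (there (there m)) with related-member p m
  ... | y , m′ , r = y , there (there m′) , r
  related-member (PH.trans p q) m with related-member p m
  ... | y , m′ , r with related-member q m′
  ...   | z , m″ , r′ = z , m″ , R-trans r r′

∧-true⁻ˡ : ∀ {a b} → a ∧ b ≡ true → a ≡ true
∧-true⁻ˡ {true} _ = refl

∧-true⁻ʳ : ∀ {a b} → a ∧ b ≡ true → b ≡ true
∧-true⁻ʳ {true} b≡true = b≡true

∧-true⁺ : ∀ {a b} → a ≡ true → b ≡ true → a ∧ b ≡ true
∧-true⁺ refl b≡true = b≡true

not-true⁻ : ∀ {b} → not b ≡ true → b ≡ false
not-true⁻ {false} _ = refl

not-true⁺ : ∀ {b} → b ≡ false → not b ≡ true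
not-true⁺ refl = refl

true≢false : ∀ {b} → b ≡ true → b ≡ false → ⊥
true≢false refl ()

∨-true⁻ : ∀ {a b} → a ∨ b ≡ true → a ≡ true ⊎ b ≡ true
∨-true⁻ {true} _ = inj₁ refl
∨-true⁻ {false} b≡true = inj₂ b≡true

∨-true⁺ˡ : ∀ {a b} → a ≡ true → a ∨ b ≡ true
∨-true⁺ˡ refl = refl

∨-true⁺ʳ : ∀ a {b} → b ≡ true → a ∨ b ≡ true
∨-true⁺ʳ a refl = ∨-zeroʳ a

does-true⁻ : ∀ {P : Set} (d : Dec P) → does d ≡ true → P
does-true⁻ (yes p) _ = p

module Trees {A : Set} where

  labelsF-++ : ∀ (xs ys : List (RTree A)) → labelsF (xs ++ ys) ≡ labelsF xs ++ labelsF ys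
  labelsF-++ [] ys = refl
  labelsF-++ (x ∷ xs) ys rewrite labelsF-++ xs ys = sym (++-assoc (labels x) (labelsF xs) (labelsF ys))

  labelsF-middle : ∀ ts₁ (t : RTree A) ts₂ →
                   labelsF (ts₁ ++ t ∷ ts₂) ↭ labels t ++ labelsF (ts₁ ++ ts₂)
  labelsF-middle ts₁ t ts₂ rewrite labelsF-++ ts₁ (t ∷ ts₂) | labelsF-++ ts₁ ts₂ =
    ↭.shifts (labelsF ts₁) (labels t)

  root∈labels : ∀ (t : RTree A) → rootLabel t ∈ labels t
  root∈labels (nd a ts) = here refl

  ∈-labelsF : ∀ {t : RTree A} {ts x} → t ∈ ts → x ∈ labels t → x ∈ labelsF ts
  ∈-labelsF {ts = t ∷ ts} (here refl) m = ∈-++⁺ˡ m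
  ∈-labelsF {ts = t′ ∷ ts} (there p) m = ∈-++⁺ʳ (labels t′) (∈-labelsF p m)

  childOf-labels : ∀ {T : RTree A} {u v} → ChildOf T u v → u ∈ labels T × v ∈ labels T
  childOf-labels (direct m) = here refl , there (∈-labelsF m (root∈labels _))
  childOf-labels (deep m c) =
    there (∈-labelsF m (proj₁ (childOf-labels c))) , there (∈-labelsF m (proj₂ (childOf-labels c)))

  childOf-lower : ∀ {T : RTree A} {u v} → ChildOf T u v → v ∈ labelsF (children T)
  childOf-lower (direct m) = ∈-labelsF m (root∈labels _)
  childOf-lower (deep m c) = ∈-labelsF m (proj₂ (childOf-labels c))

  root-not-lower : ∀ {t : RTree A} {u} → Unique (labels t) → ChildOf t u (rootLabel t) → ⊥
  root-not-lower {nd b ts} (b∉ ∷ _) c = All.lookup b∉ (childOf-lower c) refl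

  no-edge-in-leaf : ∀ {a : A} {u v} → ChildOf (nd a []) u v → ⊥
  no-edge-in-leaf (direct ())
  no-edge-in-leaf (deep () _)

  unique-subtree : ∀ {t : RTree A} {ts} → Unique (labelsF ts) → t ∈ ts → Unique (labels t)
  unique-subtree {ts = t ∷ ts} u (here refl) = proj₁ (unique-++⁻ (labels t) u)
  unique-subtree {ts = t ∷ ts} u (there p) = unique-subtree (proj₁ (proj₂ (unique-++⁻ (labels t) u))) p

  subtree-determined : ∀ {ts : List (RTree A)} {t t′ x} → Unique (labelsF ts) →
    (m : t ∈ ts) (m′ : t′ ∈ ts) → x ∈ labels t → x ∈ labels t′ →
    _≡_ {A = Σ (RTree A) (_∈ ts)} (t , m) (t′ , m′)
  subtree-determined {ts = t ∷ ts} u (here refl) (here refl) x∈ x∈′ = refl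
  subtree-determined {ts = t ∷ ts} u (here refl) (there m′) x∈ x∈′ =
    ⊥-elim (proj₂ (proj₂ (unique-++⁻ (labels t) u)) x∈ (∈-labelsF m′ x∈′))
  subtree-determined {ts = t ∷ ts} u (there m) (here refl) x∈ x∈′ =
    ⊥-elim (proj₂ (proj₂ (unique-++⁻ (labels t) u)) x∈′ (∈-labelsF m x∈))
  subtree-determined {ts = t ∷ ts} u (there m) (there m′) x∈ x∈′
    with subtree-determined (proj₁ (proj₂ (unique-++⁻ (labels t) u))) m m′ x∈ x∈′
  ... | refl = refl

  edge-determined : ∀ {T : RTree A} {u v u′ v′} → Unique (labels T) →
    (c : ChildOf T u v) (c′ : ChildOf T u′ v′) → v ≡ v′ →
    _≡_ {A = Edge T} ((u , v) , c) ((u′ , v′) , c′)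
  edge-determined (_ ∷ u) (direct {t = t} m) (direct {t = t′} m′) v≡
    with subtree-determined u m m′ (root∈labels t) (subst (_∈ labels t′) (sym v≡) (root∈labels t′))
  ... | refl = refl
  edge-determined (_ ∷ u) (direct {t = t} m) (deep {t = t′} m′ c′) v≡
    with subtree-determined u m m′ (root∈labels t) (subst (_∈ labels t′) (sym v≡) (proj₂ (childOf-labels c′)))
  ... | refl = ⊥-elim (root-not-lower (unique-subtree u m) (subst (ChildOf t _) (sym v≡) c′))
  edge-determined (_ ∷ u) (deep {t = t} m c) (direct {t = t′} m′) v≡
    with subtree-determined u m m′ (proj₂ (childOf-labels c)) (subst (_∈ labels t′) (sym v≡) (root∈labels t′))
  ... | refl = ⊥-elim (root-not-lower (unique-subtree u m) (subst (ChildOf t _) v≡ c))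
  edge-determined (_ ∷ u) (deep {t = t} m c) (deep {t = t′} m′ c′) v≡
    with subtree-determined u m m′ (proj₂ (childOf-labels c)) (subst (_∈ labels t′) (sym v≡) (proj₂ (childOf-labels c′)))
  ... | refl with edge-determined (unique-subtree u m) c c′ v≡
  ... | refl = refl

open Trees public

module Splits {A : Set} where

  splitParent : ∀ {S S₁ S₂ : RTree A} → Split S S₁ S₂ → A
  splitParent (cut {a} _ _) = a
  splitParent (down _ _ sp) = splitParent sp

  split-edge : ∀ {S S₁ S₂ : RTree A} (sp : Split S S₁ S₂) → ChildOf S (splitParent sp) (rootLabel S₂)
  split-edge (cut ts₁ ts₂) = direct (∈-insert ts₁)
  split-edge (down ts₁ ts₂ sp) = deep (∈-insert ts₁) (split-edge sp)

  split-root : ∀ {S S₁ S₂ : RTree A} (sp : Split S S₁ S₂) → rootLabel S₁ ≡ rootLabel S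
  split-root (cut _ _) = refl
  split-root (down _ _ _) = refl

  splitParent∈₁ : ∀ {S S₁ S₂ : RTree A} (sp : Split S S₁ S₂) → splitParent sp ∈ labels S₁
  splitParent∈₁ (cut _ _) = here refl
  splitParent∈₁ (down ts₁ ts₂ sp) = there (∈-labelsF (∈-insert ts₁) (splitParent∈₁ sp))

  leaf-no-split : ∀ {a} {S₁ S₂ : RTree A} → Split (nd a []) S₁ S₂ → ⊥
  leaf-no-split sp = no-edge-in-leaf (split-edge sp)

  split-embed₁ : ∀ {S S₁ S₂ : RTree A} (sp : Split S S₁ S₂) → ∀ {u v} → ChildOf S₁ u v → ChildOf S u v
  split-embed₁ (cut ts₁ ts₂) (direct m) = direct (∈-middle⁺ ts₁ m)
  split-embed₁ (cut ts₁ ts₂) (deep m c) = deep (∈-middle⁺ ts₁ m) c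
  split-embed₁ (down ts₁ ts₂ sp) (direct m) with ∈-middle⁻ ts₁ m
  ... | inj₁ refl = subst (ChildOf _ _) (sym (split-root sp)) (direct (∈-insert ts₁))
  ... | inj₂ m′ = direct (∈-middle⁺ ts₁ m′)
  split-embed₁ (down ts₁ ts₂ sp) (deep m c) with ∈-middle⁻ ts₁ m
  ... | inj₁ refl = deep (∈-insert ts₁) (split-embed₁ sp c)
  ... | inj₂ m′ = deep (∈-middle⁺ ts₁ m′) c

  split-embed₂ : ∀ {S S₁ S₂ : RTree A} (sp : Split S S₁ S₂) → ∀ {u v} → ChildOf S₂ u v → ChildOf S u v
  split-embed₂ (cut ts₁ ts₂) c = deep (∈-insert ts₁) c
  split-embed₂ (down ts₁ ts₂ sp) c = deep (∈-insert ts₁) (split-embed₂ sp c)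

  split-edges : ∀ {S S₁ S₂ : RTree A} (sp : Split S S₁ S₂) → ∀ {u v} → ChildOf S u v →
                (u ≡ splitParent sp × v ≡ rootLabel S₂) ⊎ ChildOf S₁ u v ⊎ ChildOf S₂ u v
  split-edges (cut ts₁ ts₂) (direct m) with ∈-middle⁻ ts₁ m
  ... | inj₁ refl = inj₁ (refl , refl)
  ... | inj₂ m′ = inj₂ (inj₁ (direct m′))
  split-edges (cut ts₁ ts₂) (deep m c) with ∈-middle⁻ ts₁ m
  ... | inj₁ refl = inj₂ (inj₂ c)
  ... | inj₂ m′ = inj₂ (inj₁ (deep m′ c))
  split-edges (down ts₁ ts₂ sp) (direct m) with ∈-middle⁻ ts₁ m
  ... | inj₁ refl = inj₂ (inj₁ (subst (ChildOf _ _) (split-root sp) (direct (∈-insert ts₁))))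
  ... | inj₂ m′ = inj₂ (inj₁ (direct (∈-middle⁺ ts₁ m′)))
  split-edges (down ts₁ ts₂ sp) (deep m c) with ∈-middle⁻ ts₁ m
  ... | inj₂ m′ = inj₂ (inj₁ (deep (∈-middle⁺ ts₁ m′) c))
  ... | inj₁ refl with split-edges sp c
  ...   | inj₁ deleted = inj₁ deleted
  ...   | inj₂ (inj₁ c₁) = inj₂ (inj₁ (deep (∈-insert ts₁) c₁))
  ...   | inj₂ (inj₂ c₂) = inj₂ (inj₂ c₂)

  split-labels : ∀ {S S₁ S₂ : RTree A} (sp : Split S S₁ S₂) → labels S ↭ labels S₁ ++ labels S₂
  split-labels (cut {a} {t} ts₁ ts₂) =
    prep a (↭-trans (labelsF-middle ts₁ t ts₂) (↭.++-comm (labels t) (labelsF (ts₁ ++ ts₂))))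
  split-labels (down {a} {t} {t₁} {s} ts₁ ts₂ sp) = prep a (begin
      labelsF (ts₁ ++ t ∷ ts₂)                   ↭⟨ labelsF-middle ts₁ t ts₂ ⟩
      labels t ++ F                              ↭⟨ ↭.++⁺ʳ F (split-labels sp) ⟩
      (labels t₁ ++ labels s) ++ F               ≡⟨ ++-assoc (labels t₁) (labels s) F ⟩
      labels t₁ ++ (labels s ++ F)               ↭⟨ ↭.++⁺ˡ (labels t₁) (↭.++-comm (labels s) F) ⟩
      labels t₁ ++ (F ++ labels s)               ≡⟨ ++-assoc (labels t₁) F (labels s) ⟨
      (labels t₁ ++ F) ++ labels s               ↭⟨ ↭.++⁺ʳ (labels s) (↭-sym (labelsF-middle ts₁ t₁ ts₂)) ⟩
      labelsF (ts₁ ++ t₁ ∷ ts₂) ++ labels s      ∎)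
    where
    open PermutationReasoning
    F = labelsF (ts₁ ++ ts₂)

  split-unique : ∀ {S S₁ S₂ : RTree A} (sp : Split S S₁ S₂) → Unique (labels S) →
    Unique (labels S₁) × Unique (labels S₂) × (∀ {z} → z ∈ labels S₁ → z ∈ labels S₂ → ⊥)
  split-unique {S₁ = S₁} sp u = unique-++⁻ (labels S₁) (unique-↭ (split-labels sp) u)

  split-labels₁ : ∀ {S S₁ S₂ : RTree A} (sp : Split S S₁ S₂) → ∀ {z} → z ∈ labels S₁ → z ∈ labels S
  split-labels₁ sp m = ↭.∈-resp-↭ (↭-sym (split-labels sp)) (∈-++⁺ˡ m)

  split-labels₂ : ∀ {S S₁ S₂ : RTree A} (sp : Split S S₁ S₂) → ∀ {z} → z ∈ labels S₂ → z ∈ labels S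
  split-labels₂ {S₁ = S₁} sp m = ↭.∈-resp-↭ (↭-sym (split-labels sp)) (∈-++⁺ʳ (labels S₁) m)

  edge→split : ∀ {S : RTree A} {u v} → ChildOf S u v →
    Σ (RTree A) λ S₁ → Σ (RTree A) λ S₂ → Σ (Split S S₁ S₂) λ sp → splitParent sp ≡ u × rootLabel S₂ ≡ v
  edge→split {nd a ts} (direct {t = t} m) with ∈-∃++ m
  ... | ys , zs , refl = nd a (ys ++ zs) , t , cut ys zs , refl , refl
  edge→split {nd a ts} (deep {t = t} m c) with edge→split c | ∈-∃++ m
  ... | t₁ , s , sp , u≡ , v≡ | ys , zs , refl = nd a (ys ++ t₁ ∷ zs) , s , down ys zs sp , u≡ , v≡

open Splits public

module Words {A : Set} where

  leftmost : Word A → A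
  leftmost (ltr a) = a
  leftmost ⟨ w₁ · w₂ ⟩ = leftmost w₁

  admissible-leftmost : ∀ {w} {S : RTree A} → Admissible w S → leftmost w ≡ rootLabel S
  admissible-leftmost letter = refl
  admissible-leftmost (split sp a₁ a₂) = trans (admissible-leftmost a₁) (split-root sp)

  admissible-leaf : ∀ {w} {a : A} → Admissible w (nd a []) → w ≡ ltr a
  admissible-leaf letter = refl
  admissible-leaf (split sp _ _) = ⊥-elim (leaf-no-split sp)

open Words public

module Adjacency {A : Set} where

  Adjacent : A → A → A → A → Set
  Adjacent u v u′ v′ = u ≡ u′ ⊎ u ≡ v′ ⊎ v ≡ u′ ⊎ v ≡ v′

  -- The edges of a tree are connected: a function on the edges that agrees on
  -- adjacent edges is constant.  Each edge is linked to the root edge above it.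
  module _ {B : Set} where

    private
      toRootEdge : (a : A) (ts : List (RTree A)) (f : ∀ {u v} → ChildOf (nd a ts) u v → B) →
        (∀ {u v u′ v′} (c : ChildOf (nd a ts) u v) (c′ : ChildOf (nd a ts) u′ v′) →
           Adjacent u v u′ v′ → f c ≡ f c′) →
        ∀ {u v} (c : ChildOf (nd a ts) u v) → Σ (RTree A) λ t → Σ (t ∈ ts) λ m → f c ≡ f (direct m)
      toRootEdge a ts f adj (direct m) = _ , m , refl
      toRootEdge a ts f adj (deep {t = nd b us} m c)
        with toRootEdge b us (λ c → f (deep m c)) (λ c c′ → adj (deep m c) (deep m c′)) c
      ... | _ , m′ , eq = _ , m , trans eq (adj (deep m (direct m′)) (direct m) (inj₂ (inj₁ refl)))

    constant-on-edges : (S : RTree A) (f : ∀ {u v} → ChildOf S u v → B) →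
      (∀ {u v u′ v′} (c : ChildOf S u v) (c′ : ChildOf S u′ v′) → Adjacent u v u′ v′ → f c ≡ f c′) →
      ∀ {u v u′ v′} (c : ChildOf S u v) (c′ : ChildOf S u′ v′) → f c ≡ f c′
    constant-on-edges (nd a ts) f adj c c′
      with toRootEdge a ts f adj c | toRootEdge a ts f adj c′
    ... | _ , m , eq | _ , m′ , eq′ = trans eq (trans (adj (direct m) (direct m′) (inj₁ refl)) (sym eq′))

  apart-not-adjacent : ∀ {P Q : A → Set} → (∀ {z} → P z → Q z → ⊥) →
    ∀ {u v u′ v′} → P u → P v → Q u′ → Q v′ → Adjacent u v u′ v′ → ⊥
  apart-not-adjacent apart pu pv qu′ qv′ (inj₁ refl) = apart pu qu′
  apart-not-adjacent apart pu pv qu′ qv′ (inj₂ (inj₁ refl)) = apart pu qv′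
  apart-not-adjacent apart pu pv qu′ qv′ (inj₂ (inj₂ (inj₁ refl))) = apart pv qu′
  apart-not-adjacent apart pu pv qu′ qv′ (inj₂ (inj₂ (inj₂ refl))) = apart pv qv′

open Adjacency public

module Hypergraphs {V : Set} (E : Sub V → Set) where

  _∩_ : Sub V → Sub V → Sub V
  (X ∩ Y) v = X v ∧ Y v

  ∁ : Sub V → Sub V
  ∁ X v = not (X v)

  record Separates (S X₁ X₂ : Sub V) : Set where
    field
      disjoint : Disjoint X₁ X₂
      cover    : ∀ v → v ∈ₛ S → v ∈ₛ X₁ ⊎ v ∈ₛ X₂
      uncrossed : ∀ Z → E Z → Z ⊆ₛ S → Z ⊆ₛ X₁ ⊎ Z ⊆ₛ X₂

  separates-sym : ∀ {S X₁ X₂} → Separates S X₁ X₂ → Separates S X₂ X₁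
  separates-sym s = record
    { disjoint = λ v a b → disjoint v b a
    ; cover = λ v v∈ → Data.Sum.swap (cover v v∈)
    ; uncrossed = λ Z EZ Z⊆ → Data.Sum.swap (uncrossed Z EZ Z⊆) }
    where open Separates s

  separates-⊆ : ∀ {S S′ X₁ X₂} → S′ ⊆ₛ S → Separates S X₁ X₂ → Separates S′ X₁ X₂
  separates-⊆ S′⊆S s = record
    { disjoint = disjoint
    ; cover = λ v v∈ → cover v (S′⊆S v v∈)
    ; uncrossed = λ Z EZ Z⊆ → uncrossed Z EZ (λ v v∈ → S′⊆S v (Z⊆ v v∈)) }
    where open Separates s

  connected-one-side : ∀ {S X₁ X₂} → Connected E S → Separates S X₁ X₂ →
                       ∀ {u} → u ∈ₛ S → u ∈ₛ X₁ → S ⊆ₛ X₁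
  connected-one-side {S} {X₁} {X₂} conn s {u} u∈S u∈X₁ v v∈S with Separates.cover s v v∈S
  ... | inj₁ v∈X₁ = v∈X₁
  ... | inj₂ v∈X₂ = ⊥-elim (conn (S ∩ X₁) (S ∩ X₂)
        ( (u , ∧-true⁺ u∈S u∈X₁) , (v , ∧-true⁺ v∈S v∈X₂)
        , (λ w a b → disjoint w (∧-true⁻ʳ {S w} a) (∧-true⁻ʳ {S w} b))
        , (λ w → ∧-true⁻ˡ) , (λ w → ∧-true⁻ˡ)
        , (λ w w∈S → Data.Sum.map (∧-true⁺ w∈S) (∧-true⁺ w∈S) (cover w w∈S))
        , λ Z EZ Z⊆S → Data.Sum.map (restrict Z⊆S) (restrict Z⊆S) (uncrossed Z EZ Z⊆S) ))
    where
    open Separates s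
    restrict : ∀ {Z X} → Z ⊆ₛ S → Z ⊆ₛ X → Z ⊆ₛ (S ∩ X)
    restrict Z⊆S Z⊆X w w∈Z = ∧-true⁺ (Z⊆S w w∈Z) (Z⊆X w w∈Z)

  within-component : ∀ {Hs : List (Sub V)} {H Z : Sub V} {z : V} → AllPairs Disjoint Hs → H ∈ Hs → Any (Z ⊆ₛ_) Hs →
                     z ∈ₛ Z → z ∈ₛ H → Z ⊆ₛ H
  within-component (_ ∷ _) (here refl) (here Z⊆) _ _ = Z⊆
  within-component {z = z} (H∉ ∷ _) (here refl) (there Z⊆) z∈Z z∈H with find Z⊆
  ... | H′ , m′ , Z⊆H′ = ⊥-elim (All.lookup H∉ m′ z z∈H (Z⊆H′ z z∈Z))
  within-component {z = z} (H∉ ∷ _) (there m) (here Z⊆) z∈Z z∈H =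
    ⊥-elim (All.lookup H∉ m z (Z⊆ z z∈Z) z∈H)
  within-component (_ ∷ ds) (there m) (there Z⊆) z∈Z z∈H = within-component ds m Z⊆ z∈Z z∈H

  component-separates : ∀ {S Hs H S′} → Components E S Hs → H ∈ Hs → S′ ⊆ₛ S →
                        (∀ Z → E Z → NonEmpty Z) → Separates S′ H (∁ H)
  component-separates {S} {Hs} {H} {S′} (_ , pairwise , _ , edges) H∈ S′⊆S nonempty = record
    { disjoint = λ v a b → true≢false a (not-true⁻ b)
    ; cover = λ v _ → side v
    ; uncrossed = uncrossed }
    where
    side : ∀ v → v ∈ₛ H ⊎ v ∈ₛ ∁ H
    side v with H v
    ... | true = inj₁ refl
    ... | false = inj₂ refl
    uncrossed : ∀ Z → E Z → Z ⊆ₛ S′ → Z ⊆ₛ H ⊎ Z ⊆ₛ ∁ H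
    uncrossed Z EZ Z⊆ with nonempty Z EZ
    ... | z , z∈Z with side z | edges Z EZ (λ v v∈ → S′⊆S v (Z⊆ v v∈))
    ...   | inj₁ z∈H | inZ = inj₁ (within-component pairwise H∈ inZ z∈Z z∈H)
    ...   | inj₂ z∉H | inZ = inj₂ λ v v∈Z → [ (λ v∈H → ⊥-elim (true≢false
                                  (within-component pairwise H∈ inZ v∈Z v∈H z z∈Z) (not-true⁻ z∉H)))
                                , (λ v∉H → v∉H) ]′ (side v)

module Main {A : Set} (T₀ : RTree A) (U : Unique (labels T₀)) where

  L : List A
  L = labels T₀

  E : Set
  E = Edge T₀

  G : Sub E → Set
  G = 𝔾 T₀

  open Hypergraphs G

  parent child : E → A
  parent e = proj₁ (proj₁ e)
  child e = proj₂ (proj₁ e)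

  parent∈L child∈L : (e : E) → _ ∈ L
  parent∈L e = proj₁ (childOf-labels (proj₂ e))
  child∈L e = proj₂ (childOf-labels (proj₂ e))

  edge-by-child : (e e′ : E) → child e ≡ child e′ → e ≡ e′
  edge-by-child (_ , c) (_ , c′) = edge-determined U c c′

  _≟E_ : (e e′ : E) → Dec (e ≡ e′)
  e ≟E e′ = map′ (edge-by-child e e′) (cong child) (≟-unique U (child∈L e) (child∈L e′))

  single : E → Sub E
  single e v = does (v ≟E e)

  single-spec : ∀ e → IsSingletonOf (single e) e
  single-spec e v = does-true⁻ (v ≟E e) , λ { refl → dec-true (e ≟E e) refl }

  pair : E → E → Sub E
  pair e e′ v = does (v ≟E e) ∨ does (v ≟E e′)

  pair-first : ∀ e e′ → e ∈ₛ pair e e′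
  pair-first e e′ = ∨-true⁺ˡ (dec-true (e ≟E e) refl)

  pair-second : ∀ e e′ → e′ ∈ₛ pair e e′
  pair-second e e′ = ∨-true⁺ʳ (does (e′ ≟E e)) (dec-true (e′ ≟E e′) refl)

  pair-spec : ∀ e e′ → IsPairOf (pair e e′) e e′
  pair-spec e e′ v =
      (λ v∈ → Data.Sum.map (does-true⁻ (v ≟E e)) (does-true⁻ (v ≟E e′)) (∨-true⁻ v∈))
    , λ { (inj₁ refl) → pair-first e e′ ; (inj₂ refl) → pair-second e e′ }

  singleton-⊆ : ∀ {Z X : Sub E} {e} → IsSingletonOf Z e → e ∈ₛ X → Z ⊆ₛ X
  singleton-⊆ {X = X} Z≡ e∈X v v∈Z = subst (_∈ₛ X) (sym (proj₁ (Z≡ v) v∈Z)) e∈X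

  pair-⊆ : ∀ {Z X : Sub E} {e e′} → IsPairOf Z e e′ → e ∈ₛ X → e′ ∈ₛ X → Z ⊆ₛ X
  pair-⊆ {X = X} Z≡ e∈X e′∈X v v∈Z with proj₁ (Z≡ v) v∈Z
  ... | inj₁ refl = e∈X
  ... | inj₂ refl = e′∈X

  hyperedge-nonempty : ∀ Z → G Z → NonEmpty Z
  hyperedge-nonempty Z (inj₁ (e , Z≡)) = e , proj₂ (Z≡ e) refl
  hyperedge-nonempty Z (inj₂ (e , _ , _ , _ , Z≡)) = e , proj₂ (Z≡ e) (inj₁ refl)

  singleton-≐ : ∀ {Y Y′ : Sub E} {x} → IsSingletonOf Y x → IsSingletonOf Y′ x → Y ≐ Y′
  singleton-≐ {Y} {Y′} Y≡ Y′≡ e with Y e in p | Y′ e in p′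
  ... | true | true = refl
  ... | false | false = refl
  ... | true | false = ⊥-elim (true≢false (proj₂ (Y′≡ e) (proj₁ (Y≡ e) p)) p′)
  ... | false | true = ⊥-elim (true≢false (proj₂ (Y≡ e) (proj₁ (Y′≡ e) p′)) p)

  -- A piece: a subtree S of T₀ together with its set of edges σ.
  record Piece (S : RTree A) (σ : Sub E) : Set where
    field
      edge-of  : ∀ e → e ∈ₛ σ → ChildOf S (parent e) (child e)
      embed    : ∀ {u v} → ChildOf S u v → ChildOf T₀ u v
      complete : ∀ {u v} (c : ChildOf S u v) → ((u , v) , embed c) ∈ₛ σ
      unique   : Unique (labels S)
      labels⊆  : ∀ {z} → z ∈ labels S → z ∈ L

    complete′ : ∀ e → ChildOf S (parent e) (child e) → e ∈ₛ σ
    complete′ e c = subst (_∈ₛ σ) (edge-by-child _ e refl) (complete c)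

  open Piece

  whole : Piece T₀ full
  whole = record { edge-of = λ e _ → proj₂ e ; embed = λ c → c ; complete = λ _ → refl
                 ; unique = U ; labels⊆ = λ m → m }

  piece-≐ : ∀ {S} {ρ H : Sub E} → Piece S ρ → ρ ⊆ₛ H → H ⊆ₛ ρ → Piece S H
  piece-≐ pc ρ⊆H H⊆ρ = record
    { edge-of = λ e e∈ → edge-of pc e (H⊆ρ e e∈) ; embed = embed pc
    ; complete = λ c → ρ⊆H _ (complete pc c) ; unique = unique pc ; labels⊆ = labels⊆ pc }

  -- The edges of a piece form a connected set of 𝔾(T₀): adjacent edges form a
  -- hyperedge, so they cannot be separated, and the edges of a tree are connected.
  piece-connected : ∀ {S σ} → Piece S σ → Connected G σ
  piece-connected {S} {σ} pc X₁ X₂ ((e₁ , e₁∈) , (e₂ , e₂∈) , disj , X₁⊆ , X₂⊆ , _ , uncrossed) =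
    true≢false (begin
        X₁ e₂                        ≡⟨ cong X₁ (edge-by-child e₂ _ refl) ⟩
        side (edge-of pc e₂ (X₂⊆ e₂ e₂∈)) ≡⟨ constant-on-edges S side adjacent-same _ _ ⟩
        side (edge-of pc e₁ (X₁⊆ e₁ e₁∈)) ≡⟨ cong X₁ (edge-by-child _ e₁ refl) ⟩
        X₁ e₁                        ≡⟨ e₁∈ ⟩
        true                         ∎)
      (outside-X₁ e₂ e₂∈)
    where
    open ≡.≡-Reasoning
    outside-X₁ : ∀ v → v ∈ₛ X₂ → X₁ v ≡ false
    outside-X₁ v v∈ with X₁ v in p
    ... | true = ⊥-elim (disj v p v∈)
    ... | false = refl
    edge : ∀ {u v} → ChildOf S u v → E
    edge c = _ , embed pc c
    side : ∀ {u v} → ChildOf S u v → Bool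
    side c = X₁ (edge c)
    adjacent-same : ∀ {u v u′ v′} (c : ChildOf S u v) (c′ : ChildOf S u′ v′) →
                    Adjacent u v u′ v′ → side c ≡ side c′
    adjacent-same c c′ adj with edge c ≟E edge c′
    ... | yes e≡e′ = cong X₁ e≡e′
    ... | no e≢e′ with uncrossed (pair (edge c) (edge c′)) (inj₂ (_ , _ , e≢e′ , adj , pair-spec _ _))
                                 (pair-⊆ (pair-spec _ _) (complete pc c) (complete pc c′))
    ...   | inj₁ Z⊆X₁ = trans (Z⊆X₁ _ (pair-first (edge c) (edge c′))) (sym (Z⊆X₁ _ (pair-second (edge c) (edge c′))))
    ...   | inj₂ Z⊆X₂ = trans (outside-X₁ _ (Z⊆X₂ _ (pair-first (edge c) (edge c′))))
                              (sym (outside-X₁ _ (Z⊆X₂ _ (pair-second (edge c) (edge c′)))))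

  present : RTree A → Sub E → List (Sub E)
  present (nd a []) X = []
  present (nd a (_ ∷ _)) X = X ∷ []

  present-any : ∀ (S : RTree A) X {P : Sub E → Set} {u v} → ChildOf S u v → P X → Any P (present S X)
  present-any (nd a []) X c _ = ⊥-elim (no-edge-in-leaf c)
  present-any (nd a (_ ∷ _)) X c p = here p

  present-all : ∀ (S : RTree A) X {P : Sub E → Set} → (∀ {u v} → ChildOf S u v → P X) → All P (present S X)
  present-all (nd a []) X f = []
  present-all (nd a (t ∷ _)) X f = f (direct (here refl)) ∷ []

  present-disjoint : ∀ (S S′ : RTree A) X X′ → Disjoint X X′ →
                     AllPairs Disjoint (present S X ++ present S′ X′)
  present-disjoint (nd a []) (nd b []) X X′ d = []
  present-disjoint (nd a []) (nd b (_ ∷ _)) X X′ d = [] ∷ []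
  present-disjoint (nd a (_ ∷ _)) (nd b []) X X′ d = [] ∷ []
  present-disjoint (nd a (_ ∷ _)) (nd b (_ ∷ _)) X X′ d = (d ∷ []) ∷ [] ∷ []

  leaf-or-edge : ∀ (S : RTree A) X → (present S X ≡ [] × (∀ {u v} → ChildOf S u v → ⊥))
                                   ⊎ Σ A λ u → Σ A λ v → ChildOf S u v
  leaf-or-edge (nd a []) X = inj₁ (refl , no-edge-in-leaf)
  leaf-or-edge (nd a (t ∷ ts)) X = inj₂ (_ , _ , direct (here refl))

  module Deletion {S : RTree A} {σ : Sub E} (pc : Piece S σ) {S₁ S₂ : RTree A} (sp : Split S S₁ S₂)
    (x : E) (x-parent : splitParent sp ≡ parent x) (x-child : rootLabel S₂ ≡ child x)
    (Y : Sub E) (Y≡ : IsSingletonOf Y x) where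

    unique₁ : Unique (labels S₁)
    unique₁ = proj₁ (split-unique sp (unique pc))

    unique₂ : Unique (labels S₂)
    unique₂ = proj₁ (proj₂ (split-unique sp (unique pc)))

    apart : ∀ {z} → z ∈ labels S₁ → z ∈ labels S₂ → ⊥
    apart = proj₂ (proj₂ (split-unique sp (unique pc)))

    labels₁⊆ : ∀ {z} → z ∈ labels S₁ → z ∈ L
    labels₁⊆ m = labels⊆ pc (split-labels₁ sp m)

    labels₂⊆ : ∀ {z} → z ∈ labels S₂ → z ∈ L
    labels₂⊆ m = labels⊆ pc (split-labels₂ sp m)

    -- An edge of S lies in S₁ iff its lower endpoint does, in S₂ iff its upper one does.
    σ₁ σ₂ : Sub E
    σ₁ e = σ e ∧ does (∈?-unique U (child∈L e) (labels S₁) labels₁⊆)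
    σ₂ e = σ e ∧ does (∈?-unique U (parent∈L e) (labels S₂) labels₂⊆)

    piece₁ : Piece S₁ σ₁
    piece₁ = record { edge-of = edge-of₁ ; embed = λ c → embed pc (split-embed₁ sp c)
                    ; complete = complete₁ ; unique = unique₁ ; labels⊆ = labels₁⊆ }
      where
      edge-of₁ : ∀ e → e ∈ₛ σ₁ → ChildOf S₁ (parent e) (child e)
      edge-of₁ e e∈ with split-edges sp (edge-of pc e (∧-true⁻ˡ e∈))
                       | does-true⁻ (∈?-unique U (child∈L e) (labels S₁) labels₁⊆) (∧-true⁻ʳ e∈)
      ... | inj₁ (_ , e-child) | m = ⊥-elim (apart m (subst (_∈ labels S₂) (sym e-child) (root∈labels S₂)))
      ... | inj₂ (inj₁ c) | _ = c
      ... | inj₂ (inj₂ c) | m = ⊥-elim (apart m (proj₂ (childOf-labels c)))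
      complete₁ : ∀ {u v} (c : ChildOf S₁ u v) → ((u , v) , embed pc (split-embed₁ sp c)) ∈ₛ σ₁
      complete₁ c = ∧-true⁺ (complete pc (split-embed₁ sp c))
                            (dec-true (∈?-unique U _ (labels S₁) labels₁⊆) (proj₂ (childOf-labels c)))

    piece₂ : Piece S₂ σ₂
    piece₂ = record { edge-of = edge-of₂ ; embed = λ c → embed pc (split-embed₂ sp c)
                    ; complete = complete₂ ; unique = unique₂ ; labels⊆ = labels₂⊆ }
      where
      edge-of₂ : ∀ e → e ∈ₛ σ₂ → ChildOf S₂ (parent e) (child e)
      edge-of₂ e e∈ with split-edges sp (edge-of pc e (∧-true⁻ˡ e∈))
                       | does-true⁻ (∈?-unique U (parent∈L e) (labels S₂) labels₂⊆) (∧-true⁻ʳ e∈)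
      ... | inj₁ (e-parent , _) | m = ⊥-elim (apart (subst (_∈ labels S₁) (sym e-parent) (splitParent∈₁ sp)) m)
      ... | inj₂ (inj₁ c) | m = ⊥-elim (apart (proj₁ (childOf-labels c)) m)
      ... | inj₂ (inj₂ c) | _ = c
      complete₂ : ∀ {u v} (c : ChildOf S₂ u v) → ((u , v) , embed pc (split-embed₂ sp c)) ∈ₛ σ₂
      complete₂ c = ∧-true⁺ (complete pc (split-embed₂ sp c))
                            (dec-true (∈?-unique U _ (labels S₂) labels₂⊆) (proj₁ (childOf-labels c)))

    ends₁ : ∀ e → e ∈ₛ σ₁ → parent e ∈ labels S₁ × child e ∈ labels S₁
    ends₁ e e∈ = childOf-labels (edge-of piece₁ e e∈)

    ends₂ : ∀ e → e ∈ₛ σ₂ → parent e ∈ labels S₂ × child e ∈ labels S₂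
    ends₂ e e∈ = childOf-labels (edge-of piece₂ e e∈)

    x∈σ : x ∈ₛ σ
    x∈σ = complete′ pc x (subst₂ (ChildOf S) x-parent x-child (split-edge sp))

    Y-nonempty : NonEmpty Y
    Y-nonempty = x , proj₂ (Y≡ x) refl

    Y⊆σ : Y ⊆ₛ σ
    Y⊆σ = singleton-⊆ Y≡ x∈σ

    σ₁⊆ : σ₁ ⊆ₛ (σ ∖ Y)
    σ₁⊆ e e∈ = ∧-true⁺ (∧-true⁻ˡ e∈) (not-true⁺ (e∉Y (Y e) refl))
      where
      e∉Y : ∀ b → Y e ≡ b → b ≡ false
      e∉Y true e∈Y = ⊥-elim (apart (subst (λ v → child v ∈ labels S₁) (proj₁ (Y≡ e) e∈Y) (proj₂ (ends₁ e e∈)))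
                                   (subst (_∈ labels S₂) x-child (root∈labels S₂)))
      e∉Y false _ = refl

    σ₂⊆ : σ₂ ⊆ₛ (σ ∖ Y)
    σ₂⊆ e e∈ = ∧-true⁺ (∧-true⁻ˡ e∈) (not-true⁺ (e∉Y (Y e) refl))
      where
      e∉Y : ∀ b → Y e ≡ b → b ≡ false
      e∉Y true e∈Y = ⊥-elim (apart (subst (_∈ labels S₁) x-parent (splitParent∈₁ sp))
                                   (subst (λ v → parent v ∈ labels S₂) (proj₁ (Y≡ e) e∈Y) (proj₁ (ends₂ e e∈))))
      e∉Y false _ = refl

    side : ∀ e → e ∈ₛ (σ ∖ Y) → e ∈ₛ σ₁ ⊎ e ∈ₛ σ₂
    side e e∈ with split-edges sp (edge-of pc e (∧-true⁻ˡ e∈))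
    ... | inj₁ (_ , e-child) = ⊥-elim (true≢false (proj₂ (Y≡ e) (edge-by-child e x (trans e-child x-child)))
                                                  (not-true⁻ (∧-true⁻ʳ {σ e} e∈)))
    ... | inj₂ (inj₁ c) = inj₁ (complete′ piece₁ e c)
    ... | inj₂ (inj₂ c) = inj₂ (complete′ piece₂ e c)

    separation : Separates (σ ∖ Y) σ₁ σ₂
    separation = record { disjoint = disjoint ; cover = side ; uncrossed = uncrossed }
      where
      disjoint : Disjoint σ₁ σ₂
      disjoint e e∈₁ e∈₂ = apart (proj₁ (ends₁ e e∈₁)) (proj₁ (ends₂ e e∈₂))
      -- A pair hyperedge joins adjacent edges, which cannot lie in different parts.
      uncrossed : ∀ Z → G Z → Z ⊆ₛ (σ ∖ Y) → Z ⊆ₛ σ₁ ⊎ Z ⊆ₛ σ₂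
      uncrossed Z (inj₁ (e , Z≡)) Z⊆ =
        Data.Sum.map (singleton-⊆ Z≡) (singleton-⊆ Z≡) (side e (Z⊆ e (proj₂ (Z≡ e) refl)))
      uncrossed Z (inj₂ (e , e′ , _ , adj , Z≡)) Z⊆
        with side e (Z⊆ e (proj₂ (Z≡ e) (inj₁ refl))) | side e′ (Z⊆ e′ (proj₂ (Z≡ e′) (inj₂ refl)))
      ... | inj₁ e∈ | inj₁ e′∈ = inj₁ (pair-⊆ Z≡ e∈ e′∈)
      ... | inj₂ e∈ | inj₂ e′∈ = inj₂ (pair-⊆ Z≡ e∈ e′∈)
      ... | inj₁ e∈ | inj₂ e′∈ = ⊥-elim (apart-not-adjacent apart
            (proj₁ (ends₁ e e∈)) (proj₂ (ends₁ e e∈)) (proj₁ (ends₂ e′ e′∈)) (proj₂ (ends₂ e′ e′∈)) adj)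
      ... | inj₂ e∈ | inj₁ e′∈ = ⊥-elim (apart-not-adjacent (λ m₂ m₁ → apart m₁ m₂)
            (proj₁ (ends₂ e e∈)) (proj₂ (ends₂ e e∈)) (proj₁ (ends₁ e′ e′∈)) (proj₂ (ends₁ e′ e′∈)) adj)

    component-side : ∀ H → NonEmpty H → H ⊆ₛ (σ ∖ Y) → Connected G H → H ⊆ₛ σ₁ ⊎ H ⊆ₛ σ₂
    component-side H (h , h∈) H⊆ conn with side h (H⊆ h h∈)
    ... | inj₁ h∈₁ = inj₁ (connected-one-side conn (separates-⊆ H⊆ separation) h∈ h∈₁)
    ... | inj₂ h∈₂ = inj₂ (connected-one-side conn (separates-sym (separates-⊆ H⊆ separation)) h∈ h∈₂)

    components : Components G (σ ∖ Y) (present S₁ σ₁ ++ present S₂ σ₂)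
    components =
        AllP.++⁺ (present-all S₁ σ₁ λ c → (_ , complete piece₁ c) , σ₁⊆ , piece-connected piece₁)
                 (present-all S₂ σ₂ λ c → (_ , complete piece₂ c) , σ₂⊆ , piece-connected piece₂)
      , present-disjoint S₁ S₂ σ₁ σ₂ (Separates.disjoint separation)
      , (λ e e∈ → inPart (side e e∈) e∈)
      , λ Z GZ Z⊆ → inPart′ (hyperedge-nonempty Z GZ) (Separates.uncrossed separation Z GZ Z⊆)
      where
      inPart : ∀ {e} → e ∈ₛ σ₁ ⊎ e ∈ₛ σ₂ → e ∈ₛ (σ ∖ Y) → Any (e ∈ₛ_) (present S₁ σ₁ ++ present S₂ σ₂)
      inPart {e} (inj₁ e∈) _ = AnyP.++⁺ˡ (present-any S₁ σ₁ (edge-of piece₁ e e∈) e∈)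
      inPart {e} (inj₂ e∈) _ = AnyP.++⁺ʳ (present S₁ σ₁) (present-any S₂ σ₂ (edge-of piece₂ e e∈) e∈)
      inPart′ : ∀ {Z} → NonEmpty Z → Z ⊆ₛ σ₁ ⊎ Z ⊆ₛ σ₂ → Any (Z ⊆ₛ_) (present S₁ σ₁ ++ present S₂ σ₂)
      inPart′ (z , z∈) (inj₁ Z⊆) = AnyP.++⁺ˡ (present-any S₁ σ₁ (edge-of piece₁ z (Z⊆ z z∈)) Z⊆)
      inPart′ (z , z∈) (inj₂ Z⊆) =
        AnyP.++⁺ʳ (present S₁ σ₁) (present-any S₂ σ₂ (edge-of piece₂ z (Z⊆ z z∈)) Z⊆)

    Y≐σ : (∀ {u v} → ChildOf S₁ u v → ⊥) → (∀ {u v} → ChildOf S₂ u v → ⊥) → Y ≐ σ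
    Y≐σ no₁ no₂ e with Y e in e∈Y
    ... | true = sym (Y⊆σ e e∈Y)
    ... | false with σ e in e∈σ
    ...   | false = refl
    ...   | true with side e (∧-true⁺ e∈σ (not-true⁺ e∈Y))
    ...     | inj₁ e∈ = ⊥-elim (no₁ (edge-of piece₁ e e∈))
    ...     | inj₂ e∈ = ⊥-elim (no₂ (edge-of piece₂ e e∈))

    Y≉σ₁ : ∀ {u v} → ChildOf S₁ u v → ¬ (Y ≐ σ)
    Y≉σ₁ c Y≐ = true≢false (trans (Y≐ _) (∧-true⁻ˡ (σ₁⊆ _ (complete piece₁ c))))
                           (not-true⁻ (∧-true⁻ʳ {σ _} (σ₁⊆ _ (complete piece₁ c))))

    Y≉σ₂ : ∀ {u v} → ChildOf S₂ u v → ¬ (Y ≐ σ)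
    Y≉σ₂ c Y≐ = true≢false (trans (Y≐ _) (∧-true⁻ˡ (σ₂⊆ _ (complete piece₂ c))))
                           (not-true⁻ (∧-true⁻ʳ {σ _} (σ₂⊆ _ (complete piece₂ c))))

    construct-of-parts : ∀ {ts} → Pointwise (IsConstruct G) (present S₁ σ₁ ++ present S₂ σ₂) ts →
                         IsConstruct G σ (node Y ts)
    construct-of-parts pw with leaf-or-edge S₁ σ₁ | leaf-or-edge S₂ σ₂
    ... | inj₂ (_ , _ , c) | _ = step _ Y-nonempty Y⊆σ (Y≉σ₁ c) components pw
    ... | inj₁ _ | inj₂ (_ , _ , c) = step _ Y-nonempty Y⊆σ (Y≉σ₂ c) components pw
    ... | inj₁ (none₁ , no₁) | inj₁ (none₂ , no₂) =
      subst (λ ts → IsConstruct G σ (node Y ts)) (sym (no-children (subst (λ Hs → Pointwise _ Hs _) (cong₂ _++_ none₁ none₂) pw)))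
            (top Y-nonempty (Y≐σ no₁ no₂))
      where
      no-children : ∀ {R : Sub E → CTree E → Set} {ts} → Pointwise R [] ts → ts ≡ []
      no-children [] = refl

  STree : Set
  STree = Σ (CTree E) AllSingletons

  strees : (ts : List (CTree E)) → All AllSingletons ts → List STree
  strees [] [] = []
  strees (t ∷ ts) (a ∷ as) = (t , a) ∷ strees ts as

  -- A child of a construction, which is a construction of the edges of a part S′
  -- of a split; it carries the induction hypothesis Q.
  record Item (Q : STree → Set) (S′ : RTree A) : Set where
    constructor item
    field
      set       : Sub E
      tree      : CTree E
      constr    : IsConstruct G set tree
      singles   : AllSingletons tree
      piece     : Piece S′ set
      inhabited : NonEmpty set
      ih        : Q (tree , singles)

    stree : STree
    stree = tree , singles

  open Item

  item-edge : ∀ {Q S′} → Item Q S′ → Σ A λ u → Σ A λ v → ChildOf S′ u v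
  item-edge i = _ , _ , edge-of (piece i) _ (proj₂ (inhabited i))

  Part : (STree → Set) → RTree A → Set
  Part Q (nd a []) = ⊤
  Part Q (nd a (t ∷ ts)) = Item Q (nd a (t ∷ ts))

  partTrees : ∀ {Q} (S′ : RTree A) → Part Q S′ → List STree
  partTrees (nd a []) _ = []
  partTrees (nd a (t ∷ ts)) i = stree i ∷ []

  no-part : ∀ {Q} (S′ : RTree A) → (∀ {u v} → ChildOf S′ u v → ⊥) → Σ (Part Q S′) λ p → partTrees S′ p ≡ []
  no-part (nd a []) _ = tt , refl
  no-part (nd a (t ∷ ts)) edgeless = ⊥-elim (edgeless (direct (here refl)))

  one-part : ∀ {Q} (S′ : RTree A) (i : Item Q S′) → Σ (Part Q S′) λ p → partTrees S′ p ≡ stree i ∷ []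
  one-part (nd a []) i = ⊥-elim (no-edge-in-leaf (proj₂ (proj₂ (item-edge i))))
  one-part (nd a (t ∷ ts)) i = i , refl

  module _ {Q : STree → Set} (S₁ S₂ : RTree A) where

    SideItem : Set
    SideItem = Item Q S₁ ⊎ Item Q S₂

    sideTree : SideItem → STree
    sideTree = Data.Sum.[ stree , stree ]′

    OnSide₁ OnSide₂ : SideItem → Set
    OnSide₁ i = Data.Sum.[ (λ _ → ⊤) , (λ _ → ⊥) ]′ i
    OnSide₂ i = Data.Sum.[ (λ _ → ⊥) , (λ _ → ⊤) ]′ i

    OtherSides : SideItem → SideItem → Set
    OtherSides (inj₁ _) (inj₁ _) = ⊥
    OtherSides (inj₂ _) (inj₂ _) = ⊥
    OtherSides _ _ = ⊤

    combine : ∀ {xs ys zs} → Σ (Part Q S₁) (λ p₁ → partTrees S₁ p₁ ≡ ys) →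
              Σ (Part Q S₂) (λ p₂ → partTrees S₂ p₂ ≡ zs) → xs ↭ ys ++ zs →
              Σ (Part Q S₁) λ p₁ → Σ (Part Q S₂) λ p₂ → xs ↭ partTrees S₁ p₁ ++ partTrees S₂ p₂
    combine (p₁ , refl) (p₂ , refl) xs↭ = p₁ , p₂ , xs↭

    arrange : (is : List SideItem) → AllPairs OtherSides is →
      (∀ {u v} → ChildOf S₁ u v → Any OnSide₁ is) → (∀ {u v} → ChildOf S₂ u v → Any OnSide₂ is) →
      Σ (Part Q S₁) λ p₁ → Σ (Part Q S₂) λ p₂ → map sideTree is ↭ partTrees S₁ p₁ ++ partTrees S₂ p₂
    arrange [] _ has₁ has₂ = combine (no-part S₁ λ c → none (has₁ c)) (no-part S₂ λ c → none (has₂ c)) ↭-refl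
      where
      none : ∀ {P : SideItem → Set} → Any P [] → ⊥
      none ()
    arrange (inj₁ i ∷ []) _ has₁ has₂ = combine (one-part S₁ i) (no-part S₂ λ c → none (has₂ c)) ↭-refl
      where
      none : Any OnSide₂ (inj₁ i ∷ []) → ⊥
      none (here ())
      none (there ())
    arrange (inj₂ i ∷ []) _ has₁ has₂ = combine (no-part S₁ λ c → none (has₁ c)) (one-part S₂ i) ↭-refl
      where
      none : Any OnSide₁ (inj₂ i ∷ []) → ⊥
      none (here ())
      none (there ())
    arrange (inj₁ i ∷ inj₂ j ∷ []) _ _ _ = combine (one-part S₁ i) (one-part S₂ j) ↭-refl
    arrange (inj₂ j ∷ inj₁ i ∷ []) _ _ _ = combine (one-part S₁ i) (one-part S₂ j) (swap _ _ ↭-refl)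
    arrange (inj₁ _ ∷ inj₁ _ ∷ _) ((() ∷ _) ∷ _) _ _
    arrange (inj₂ _ ∷ inj₂ _ ∷ _) ((() ∷ _) ∷ _) _ _
    arrange (inj₁ _ ∷ inj₂ _ ∷ inj₁ _ ∷ _) ((_ ∷ () ∷ _) ∷ _) _ _
    arrange (inj₁ _ ∷ inj₂ _ ∷ inj₂ _ ∷ _) (_ ∷ (() ∷ _) ∷ _) _ _
    arrange (inj₂ _ ∷ inj₁ _ ∷ inj₁ _ ∷ _) (_ ∷ (() ∷ _) ∷ _) _ _
    arrange (inj₂ _ ∷ inj₁ _ ∷ inj₂ _ ∷ _) ((_ ∷ () ∷ _) ∷ _) _ _


  module Shape {S : RTree A} {σ : Sub E} (pc : Piece S σ) {S₁ S₂ : RTree A} (sp : Split S S₁ S₂)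
    (x : E) (x-parent : splitParent sp ≡ parent x) (x-child : rootLabel S₂ ≡ child x)
    (Y : Sub E) (Y≡ : IsSingletonOf Y x) where

    open Deletion pc sp x x-parent x-child Y Y≡ public

    -- A component of σ ∖ {x} inside a part contains, being connected, all of it.
    fills : ∀ {Sj σj Hs H} → Piece Sj σj → σj ⊆ₛ (σ ∖ Y) → Components G (σ ∖ Y) Hs → H ∈ Hs →
            NonEmpty H → H ⊆ₛ σj → σj ⊆ₛ H
    fills pcj σj⊆ comps H∈ (h , h∈) H⊆ =
      connected-one-side (piece-connected pcj) (component-separates comps H∈ σj⊆ hyperedge-nonempty)
                         (H⊆ h h∈) h∈

    module _ {Q : STree → Set} where

      sideSet : SideItem {Q} S₁ S₂ → Sub E
      sideSet = Data.Sum.[ set , set ]′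

      sort-children : ∀ {Hs} → Components G (σ ∖ Y) Hs → ∀ Hs′ {ts} → (∀ {H} → H ∈ Hs′ → H ∈ Hs) →
        All (λ H → NonEmpty H × H ⊆ₛ (σ ∖ Y) × Connected G H) Hs′ →
        Pointwise (IsConstruct G) Hs′ ts → (as : All AllSingletons ts) → All Q (strees ts as) →
        Σ (List (SideItem S₁ S₂)) λ is → map (sideTree S₁ S₂) is ≡ strees ts as × map sideSet is ≡ Hs′
      sort-children comps [] _ [] [] [] [] = [] , refl , refl
      sort-children comps (H ∷ Hs′) Hs′⊆ ((ne , H⊆ , conn) ∷ cs) (ic ∷ pw) (a ∷ as) (q ∷ qs)
        with sort-children comps Hs′ (λ m → Hs′⊆ (there m)) cs pw as qs | component-side H ne H⊆ conn
      ... | is , trees≡ , sets≡ | inj₁ H⊆₁ =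
        inj₁ (item H _ ic a (piece-≐ piece₁ (fills piece₁ σ₁⊆ comps (Hs′⊆ (here refl)) ne H⊆₁) H⊆₁) ne q) ∷ is ,
        cong (_ ∷_) trees≡ , cong (H ∷_) sets≡
      ... | is , trees≡ , sets≡ | inj₂ H⊆₂ =
        inj₂ (item H _ ic a (piece-≐ piece₂ (fills piece₂ σ₂⊆ comps (Hs′⊆ (here refl)) ne H⊆₂) H⊆₂) ne q) ∷ is ,
        cong (_ ∷_) trees≡ , cong (H ∷_) sets≡

      -- Two items on the same side share that side's edges, so disjoint items lie on different sides.
      other-sides : ∀ {i j : SideItem S₁ S₂} → Disjoint (sideSet i) (sideSet j) → OtherSides S₁ S₂ i j
      other-sides {inj₁ i} {inj₁ j} d with inhabited i
      ... | h , h∈ = d h h∈ (complete′ (piece j) h (edge-of (piece i) h h∈))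
      other-sides {inj₁ i} {inj₂ j} d = tt
      other-sides {inj₂ i} {inj₁ j} d = tt
      other-sides {inj₂ i} {inj₂ j} d with inhabited i
      ... | h , h∈ = d h h∈ (complete′ (piece j) h (edge-of (piece i) h h∈))

      shape : ∀ ts (as : All AllSingletons ts) → IsConstruct G σ (node Y ts) → All Q (strees ts as) →
        Σ (Part Q S₁) λ p₁ → Σ (Part Q S₂) λ p₂ → strees ts as ↭ partTrees S₁ p₁ ++ partTrees S₂ p₂
      shape [] [] (top _ Y≐) [] = combine S₁ S₂ (no-part S₁ λ c → Y≉σ₁ c Y≐) (no-part S₂ λ c → Y≉σ₂ c Y≐) ↭-refl
      shape ts as (step Hs _ _ _ comps pw) qs
        with sort-children comps Hs (λ m → m) (proj₁ comps) pw as qs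
      ... | is , trees≡ , sets≡ with arrange S₁ S₂ is pairwise has₁ has₂
        where
        pairwise : AllPairs (OtherSides S₁ S₂) is
        pairwise = APr.map other-sides (APP.map⁻ (subst (AllPairs Disjoint) (sym sets≡) (proj₁ (proj₂ comps))))
        covering : ∀ e → e ∈ₛ (σ ∖ Y) → Any (λ i → e ∈ₛ sideSet i) is
        covering e e∈ = AnyP.map⁻ (subst (Any (e ∈ₛ_)) (sym sets≡) (proj₁ (proj₂ (proj₂ comps)) e e∈))
        has₁ : ∀ {u v} → ChildOf S₁ u v → Any (OnSide₁ S₁ S₂) is
        has₁ c = Any.map (λ { {inj₁ _} _ → tt
                            ; {inj₂ j} e∈ → Separates.disjoint separation _ (complete piece₁ c)
                                              (complete′ piece₂ _ (edge-of (piece j) _ e∈)) })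
                         (covering _ (σ₁⊆ _ (complete piece₁ c)))
        has₂ : ∀ {u v} → ChildOf S₂ u v → Any (OnSide₂ S₁ S₂) is
        has₂ c = Any.map (λ { {inj₂ _} _ → tt
                            ; {inj₁ j} e∈ → Separates.disjoint separation _
                                              (complete′ piece₁ _ (edge-of (piece j) _ e∈)) (complete piece₂ c) })
                         (covering _ (σ₂⊆ _ (complete piece₂ c)))
      ... | p₁ , p₂ , arranged = p₁ , p₂ , subst (_↭ _) trees≡ arranged

  -- Words whose first letter is a node of T₀, so that first letters can be compared.
  NWord : Set
  NWord = Σ (Word A) λ w → leftmost w ∈ L

  pick : (NWord → Bool) → NWord → List NWord → NWord
  pick p d [] = d
  pick p d (w ∷ ws) = if p w then w else pick p d ws

  pick-none : ∀ p d (ws : List NWord) → (∀ w → w ∈ ws → p w ≡ false) → pick p d ws ≡ d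
  pick-none p d [] _ = refl
  pick-none p d (w ∷ ws) none with p w in pw
  ... | true = ⊥-elim (true≢false pw (none w (here refl)))
  ... | false = pick-none p d ws (λ w′ m → none w′ (there m))

  pick-unique : ∀ p d (ws : List NWord) w₀ → w₀ ∈ ws → p w₀ ≡ true →
                (∀ w → w ∈ ws → p w ≡ true → w ≡ w₀) → pick p d ws ≡ w₀
  pick-unique p d (w ∷ ws) w₀ m pw₀ unique with p w in pw
  ... | true = unique w (here refl) pw
  pick-unique p d (w ∷ ws) w₀ (here refl) pw₀ unique | false = ⊥-elim (true≢false pw₀ pw)
  pick-unique p d (w ∷ ws) w₀ (there m) pw₀ unique | false =
    pick-unique p d ws w₀ m pw₀ (λ w′ m′ → unique w′ (there m′))

  -- Does the word start at the lower endpoint of x, i.e. is it a word of the part below x?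
  below : E → NWord → Bool
  below x w = does (≟-unique U (proj₂ w) (child∈L x))

  -- The word of a construction with root {x}: the children's words are sorted into
  -- the one below x and the other one; a missing side is the corresponding endpoint of x.
  join : E → List NWord → NWord
  join x ws = ⟨ proj₁ upper · proj₁ lower ⟩ , proj₂ upper
    where
    lower = pick (below x) (ltr (child x) , child∈L x) ws
    upper = pick (λ w → not (below x w)) (ltr (parent x) , parent∈L x) ws

  mutual
    word : (t : CTree E) → AllSingletons t → NWord
    word (node Y ts) (node (x , _) as) = join x (words ts as)

    words : (ts : List (CTree E)) → All AllSingletons ts → List NWord
    words [] [] = []
    words (t ∷ ts) (a ∷ as) = word t a ∷ words ts as

  word′ : STree → NWord
  word′ (t , a) = word t a

  words-strees : ∀ ts as → words ts as ≡ map word′ (strees ts as)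
  words-strees [] [] = refl
  words-strees (t ∷ ts) (a ∷ as) = cong (_ ∷_) (words-strees ts as)

  second-first : Word A → A
  second-first (ltr a) = a
  second-first ⟨ _ · w ⟩ = leftmost w

  word-second-first : ∀ Y ts x (Y≡ : IsSingletonOf Y x) as →
                      second-first (proj₁ (word (node Y ts) (node (x , Y≡) as))) ≡ child x
  word-second-first Y ts x Y≡ as = lower-first (words ts as)
    where
    lower-first : ∀ ws → leftmost (proj₁ (pick (below x) (ltr (child x) , child∈L x) ws)) ≡ child x
    lower-first [] = refl
    lower-first (w ∷ ws) with below x w in bw
    ... | true = does-true⁻ (≟-unique U (proj₂ w) (child∈L x)) bw
    ... | false = lower-first ws

  partWord : ∀ {Q} (S′ : RTree A) → Part Q S′ → Word A → Word A
  partWord (nd a []) _ d = d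
  partWord (nd a (_ ∷ _)) i _ = proj₁ (word′ (stree i))

  partWords : ∀ {Q} (S′ : RTree A) → Part Q S′ → List NWord
  partWords S′ p = map word′ (partTrees S′ p)

  word-of-parts : ∀ {Q} (S₁ S₂ : RTree A) (p₁ : Part Q S₁) (p₂ : Part Q S₂) x Y (Y≡ : IsSingletonOf Y x) ts as →
    strees ts as ↭ partTrees S₁ p₁ ++ partTrees S₂ p₂ →
    All (λ w → below x w ≡ false) (partWords S₁ p₁) → All (λ w → below x w ≡ true) (partWords S₂ p₂) →
    proj₁ (word (node Y ts) (node (x , Y≡) as)) ≡ ⟨ partWord S₁ p₁ (ltr (parent x)) · partWord S₂ p₂ (ltr (child x)) ⟩
  word-of-parts S₁ S₂ p₁ p₂ x Y Y≡ ts as arranged uppers lowers =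
    cong₂ ⟨_·_⟩ (upper-word S₁ S₂ p₁ p₂ ws↭ uppers lowers) (lower-word S₁ S₂ p₁ p₂ ws↭ uppers lowers)
    where
    ws↭ : words ts as ↭ partWords S₁ p₁ ++ partWords S₂ p₂
    ws↭ = subst (_↭ _) (sym (words-strees ts as))
            (↭-trans (↭.map⁺ word′ arranged) (↭-reflexive (map-++ word′ (partTrees S₁ p₁) (partTrees S₂ p₂))))

    lower-word : ∀ {Q} (S₁ S₂ : RTree A) (p₁ : Part Q S₁) (p₂ : Part Q S₂) {ws} →
      ws ↭ partWords S₁ p₁ ++ partWords S₂ p₂ →
      All (λ w → below x w ≡ false) (partWords S₁ p₁) → All (λ w → below x w ≡ true) (partWords S₂ p₂) →
      proj₁ (pick (below x) (ltr (child x) , child∈L x) ws) ≡ partWord S₂ p₂ (ltr (child x))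
    lower-word S₁ (nd a []) p₁ p₂ {ws} ws↭ uppers lowers =
      cong proj₁ (pick-none _ _ ws λ w m →
        All.lookup uppers (subst (w ∈_) (++-identityʳ _) (↭.∈-resp-↭ ws↭ m)))
    lower-word S₁ (nd a (_ ∷ _)) p₁ i {ws} ws↭ uppers lowers =
      cong proj₁ (pick-unique _ _ ws _ (↭.∈-resp-↭ (↭-sym ws↭) (∈-++⁺ʳ (partWords S₁ p₁) (here refl)))
                              (All.lookup lowers (here refl)) only)
      where
      only : ∀ w → w ∈ ws → below x w ≡ true → w ≡ word′ (stree i)
      only w m bw with ∈-++⁻ (partWords S₁ p₁) (↭.∈-resp-↭ ws↭ m)
      ... | inj₁ m′ = ⊥-elim (true≢false bw (All.lookup uppers m′))
      ... | inj₂ (here refl) = refl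

    upper-word : ∀ {Q} (S₁ S₂ : RTree A) (p₁ : Part Q S₁) (p₂ : Part Q S₂) {ws} →
      ws ↭ partWords S₁ p₁ ++ partWords S₂ p₂ →
      All (λ w → below x w ≡ false) (partWords S₁ p₁) → All (λ w → below x w ≡ true) (partWords S₂ p₂) →
      proj₁ (pick (λ w → not (below x w)) (ltr (parent x) , parent∈L x) ws) ≡ partWord S₁ p₁ (ltr (parent x))
    upper-word (nd a []) S₂ p₁ p₂ {ws} ws↭ uppers lowers =
      cong proj₁ (pick-none _ _ ws λ w m → cong not (All.lookup lowers (↭.∈-resp-↭ ws↭ m)))
    upper-word (nd a (_ ∷ _)) S₂ i p₂ {ws} ws↭ uppers lowers =
      cong proj₁ (pick-unique _ _ ws _ (↭.∈-resp-↭ (↭-sym ws↭) (here refl))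
                              (cong not (All.lookup uppers (here refl))) only)
      where
      only : ∀ w → w ∈ ws → not (below x w) ≡ true → w ≡ word′ (stree i)
      only w m bw with ↭.∈-resp-↭ ws↭ m
      ... | here refl = refl
      ... | there m′ = ⊥-elim (true≢false (All.lookup lowers m′) (not-true⁻ bw))

  AdmissibleItems : (STree → Set) → RTree A → Set
  AdmissibleItems Q S′ = ∀ (i : Item Q S′) → Admissible (proj₁ (word′ (stree i))) S′

  part-all : ∀ {Q} (S′ : RTree A) (p : Part Q S′) (P : NWord → Set) →
             (∀ (i : Item Q S′) → P (word′ (stree i))) → All P (partWords S′ p)
  part-all (nd a []) p P f = []
  part-all (nd a (_ ∷ _)) i P f = f i ∷ []

  module Decompose {S : RTree A} {σ : Sub E} (pc : Piece S σ) {S₁ S₂ : RTree A} (sp : Split S S₁ S₂)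
    (x : E) (x-parent : splitParent sp ≡ parent x) (x-child : rootLabel S₂ ≡ child x)
    (Y : Sub E) (Y≡ : IsSingletonOf Y x) where

    open Shape pc sp x x-parent x-child Y Y≡ public

    -- Admissible words start at the root of their part, which tells the parts apart.
    uppers : ∀ {Q} → AdmissibleItems Q S₁ → (p₁ : Part Q S₁) → All (λ w → below x w ≡ false) (partWords S₁ p₁)
    uppers adm p₁ = part-all S₁ p₁ _ λ i → dec-false (≟-unique U (proj₂ (word′ (stree i))) (child∈L x)) λ first≡ →
      apart (root∈labels S₁) (subst (_∈ labels S₂)
        (trans x-child (trans (sym first≡) (admissible-leftmost (adm i)))) (root∈labels S₂))

    lowers : ∀ {Q} → AdmissibleItems Q S₂ → (p₂ : Part Q S₂) → All (λ w → below x w ≡ true) (partWords S₂ p₂)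
    lowers adm p₂ = part-all S₂ p₂ _ λ i →
      dec-true (≟-unique U (proj₂ (word′ (stree i))) (child∈L x)) (trans (admissible-leftmost (adm i)) x-child)

    decompose : ∀ {Q} → AdmissibleItems Q S₁ → AdmissibleItems Q S₂ →
      ∀ ts as → IsConstruct G σ (node Y ts) → All Q (strees ts as) →
      Σ (Part Q S₁) λ p₁ → Σ (Part Q S₂) λ p₂ →
        (strees ts as ↭ partTrees S₁ p₁ ++ partTrees S₂ p₂) ×
        (proj₁ (word (node Y ts) (node (x , Y≡) as))
           ≡ ⟨ partWord S₁ p₁ (ltr (parent x)) · partWord S₂ p₂ (ltr (child x)) ⟩)
    decompose adm₁ adm₂ ts as ic qs with shape ts as ic qs
    ... | p₁ , p₂ , arranged =
      p₁ , p₂ , arranged , word-of-parts S₁ S₂ p₁ p₂ x Y Y≡ ts as arranged (uppers adm₁ p₁) (lowers adm₂ p₂)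

  root∈ : ∀ {σ Y ts x} → IsConstruct G σ (node Y ts) → IsSingletonOf Y x → x ∈ₛ σ
  root∈ (top _ Y≐) Y≡ = trans (sym (Y≐ _)) (proj₂ (Y≡ _) refl)
  root∈ (step _ _ Y⊆ _ _ _) Y≡ = Y⊆ _ (proj₂ (Y≡ _) refl)

  IsAdmissible : STree → Set
  IsAdmissible (t , a) = ∀ {S σ} → Piece S σ → IsConstruct G σ t → Admissible (proj₁ (word t a)) S

  part-admissible : ∀ (S′ : RTree A) (p : Part IsAdmissible S′) d → d ∈ labels S′ →
                    Admissible (partWord S′ p (ltr d)) S′
  part-admissible (nd r []) p d (here refl) = letter
  part-admissible (nd r (_ ∷ _)) i d _ = ih i (piece i) (constr i)

  mutual
    admissible : ∀ t a → IsAdmissible (t , a)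
    admissible (node Y ts) (node (x , Y≡) as) {S} pc ic with edge→split (edge-of pc x (root∈ ic Y≡))
    ... | S₁ , S₂ , sp , x-parent , x-child with
          Decompose.decompose pc sp x x-parent x-child Y Y≡ (λ i → ih i (piece i) (constr i))
                              (λ i → ih i (piece i) (constr i)) ts as ic (admissibles ts as)
    ... | p₁ , p₂ , _ , word≡ = subst (λ w → Admissible w S) (sym word≡)
          (split sp (part-admissible S₁ p₁ (parent x) (subst (_∈ labels S₁) x-parent (splitParent∈₁ sp)))
                    (part-admissible S₂ p₂ (child x) (subst (_∈ labels S₂) x-child (root∈labels S₂))))

    admissibles : ∀ ts as → All IsAdmissible (strees ts as)
    admissibles [] [] = []
    admissibles (t ∷ ts) (a ∷ as) = admissible t a ∷ admissibles ts as

  items-admissible : ∀ {Q S′} → AdmissibleItems Q S′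
  items-admissible i = admissible (tree i) (singles i) (piece i) (constr i)

  Preimage : Sub E → Word A → Set
  Preimage σ w = Σ (CTree E) λ t → IsConstruct G σ t × Σ (AllSingletons t) λ a → proj₁ (word t a) ≡ w

  -- The trivial induction hypothesis, for constructions that are only inspected.
  NoHyp : STree → Set
  NoHyp _ = ⊤

  PartPreimage : RTree A → Sub E → Word A → Set
  PartPreimage S′ σ′ w = Σ (Part NoHyp S′) λ p → (∀ d → d ∈ labels S′ → partWord S′ p (ltr d) ≡ w) ×
                           Pointwise (IsConstruct G) (present S′ σ′) (map proj₁ (partTrees S′ p))

  unstrees : (l : List STree) → Σ (All AllSingletons (map proj₁ l)) λ as → strees (map proj₁ l) as ≡ l
  unstrees [] = [] , refl
  unstrees ((t , a) ∷ l) with unstrees l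
  ... | as , strees≡ = a ∷ as , cong (_ ∷_) strees≡

  deleted : ∀ {S σ S₁ S₂} → Piece S σ → Split S S₁ S₂ → E
  deleted pc sp = (splitParent sp , _) , embed pc (split-edge sp)

  module Joining {S : RTree A} {σ : Sub E} (pc : Piece S σ) {S₁ S₂ : RTree A} (sp : Split S S₁ S₂) where

    x : E
    x = deleted pc sp

    open Decompose pc sp x refl refl (single x) (single-spec x) public

    join-preimages : ∀ {w₁ w₂} → PartPreimage S₁ σ₁ w₁ → PartPreimage S₂ σ₂ w₂ → Preimage σ ⟨ w₁ · w₂ ⟩
    join-preimages (p₁ , word₁≡ , pw₁) (p₂ , word₂≡ , pw₂) with unstrees (partTrees S₁ p₁ ++ partTrees S₂ p₂)
    ... | as , strees≡ =
      node (single x) ts ,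
      construct-of-parts (subst (Pointwise _ _) (sym (map-++ proj₁ (partTrees S₁ p₁) _)) (PWP.++⁺ pw₁ pw₂)) ,
      node (x , single-spec x) as ,
      trans (word-of-parts S₁ S₂ p₁ p₂ x _ (single-spec x) ts as (↭-reflexive strees≡)
                           (uppers items-admissible p₁) (lowers items-admissible p₂))
            (cong₂ ⟨_·_⟩ (word₁≡ _ (splitParent∈₁ sp)) (word₂≡ _ (root∈labels S₂)))
      where
      ts = map proj₁ (partTrees S₁ p₁ ++ partTrees S₂ p₂)

  mutual
    surjective : ∀ {S σ w u v} → Piece S σ → ChildOf S u v → Admissible w S → Preimage σ w
    surjective pc c letter = ⊥-elim (no-edge-in-leaf c)
    surjective pc _ (split sp adm₁ adm₂) =
      join-preimages (surjective-part piece₁ adm₁) (surjective-part piece₂ adm₂)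
      where open Joining pc sp

    surjective-part : ∀ {S′ σ′ w} → Piece S′ σ′ → Admissible w S′ → PartPreimage S′ σ′ w
    surjective-part {nd a []} pc adm = tt , (λ { d (here refl) → sym (admissible-leaf adm) }) , []
    surjective-part {nd a (t ∷ ts)} {σ′} pc adm with surjective pc (direct (here refl)) adm
    ... | c , ic , as , word≡ =
      item σ′ c ic as pc (_ , complete pc (direct (here refl))) tt , (λ _ _ → word≡) , ic ∷ []

  ≈T-refl : ∀ (t : CTree E) → t ≈T t
  ≈T-refl (node Y ts) = node≈ (λ _ → refl) (PH.refl (pointwise-refl ts))
    where
    pointwise-refl : (ts : List (CTree E)) → Pointwise _≈T_ ts ts
    pointwise-refl [] = []
    pointwise-refl (t ∷ ts) = ≈T-refl t ∷ pointwise-refl ts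

  ≈T-trans : ∀ {t t′ t″ : CTree E} → t ≈T t′ → t′ ≈T t″ → t ≈T t″
  ≈T-trans (node≈ Y≐ p) (node≈ Y≐′ p′) = node≈ (λ v → trans (Y≐ v) (Y≐′ v)) (PH.trans p p′)

  ↭⇒≈ : ∀ {ts ts′ : List (CTree E)} → ts ↭ ts′ → PH.Permutation _≈T_ ts ts′
  ↭⇒≈ p = PH.map (λ { {t} refl → ≈T-refl t }) (↭⇒↭ₛ p)

  ⟨⟩-injective : ∀ {a b c d : Word A} → ⟨ a · b ⟩ ≡ ⟨ c · d ⟩ → a ≡ c × b ≡ d
  ⟨⟩-injective refl = refl , refl

  trees-perm : ∀ {Q} (S₁ S₂ : RTree A) (p₁ : Part Q S₁) (p₂ : Part Q S₂) ts as →
    strees ts as ↭ partTrees S₁ p₁ ++ partTrees S₂ p₂ →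
    ts ↭ map proj₁ (partTrees S₁ p₁) ++ map proj₁ (partTrees S₂ p₂)
  trees-perm S₁ S₂ p₁ p₂ ts as arranged =
    subst (_↭ _) (trees-strees ts as)
      (↭-trans (↭.map⁺ proj₁ arranged) (↭-reflexive (map-++ proj₁ (partTrees S₁ p₁) (partTrees S₂ p₂))))
    where
    trees-strees : ∀ ts as → map proj₁ (strees ts as) ≡ ts
    trees-strees [] [] = refl
    trees-strees (t ∷ ts) (a ∷ as) = cong (t ∷_) (trees-strees ts as)

  all-trivial : ∀ (l : List STree) → All NoHyp l
  all-trivial [] = []
  all-trivial (_ ∷ l) = tt ∷ all-trivial l

  IsInjective : STree → Set
  IsInjective (t , a) = ∀ {S σ σ′} → Piece S σ → Piece S σ′ → IsConstruct G σ t →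
    ∀ t′ a′ → IsConstruct G σ′ t′ → proj₁ (word t a) ≡ proj₁ (word t′ a′) → t ≈T t′

  injective-part : ∀ (S′ : RTree A) (p : Part IsInjective S′) (p′ : Part NoHyp S′) d →
    partWord S′ p d ≡ partWord S′ p′ d → Pointwise _≈T_ (map proj₁ (partTrees S′ p)) (map proj₁ (partTrees S′ p′))
  injective-part (nd a []) _ _ _ _ = []
  injective-part (nd a (_ ∷ _)) i i′ _ eq = ih i (piece i) (piece i′) (constr i) (tree i′) (singles i′) (constr i′) eq ∷ []

  mutual
    injective : ∀ t a → IsInjective (t , a)
    injective (node Y ts) (node (x , Y≡) as) pc pc′ ic (node Y′ ts′) (node (x′ , Y′≡) as′) ic′ eq
      with edge-by-child x x′ (trans (sym (word-second-first Y ts x Y≡ as))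
                                     (trans (cong second-first eq) (word-second-first Y′ ts′ x′ Y′≡ as′)))
    ... | refl with edge→split (edge-of pc x (root∈ ic Y≡))
    ... | S₁ , S₂ , sp , x-parent , x-child
      with Decompose.decompose pc sp x x-parent x-child Y Y≡ items-admissible items-admissible
                               ts as ic (injectives ts as)
         | Decompose.decompose pc′ sp x x-parent x-child Y′ Y′≡ items-admissible items-admissible
                               ts′ as′ ic′ (all-trivial _)
    ... | p₁ , p₂ , arranged , word≡ | p₁′ , p₂′ , arranged′ , word≡′
      with ⟨⟩-injective (trans (sym word≡) (trans eq word≡′))
    ... | eq₁ , eq₂ = node≈ (singleton-≐ Y≡ Y′≡)
      (PH.trans (↭⇒≈ (trees-perm S₁ S₂ p₁ p₂ ts as arranged))
      (PH.trans (PH.refl (PWP.++⁺ (injective-part S₁ p₁ p₁′ _ eq₁) (injective-part S₂ p₂ p₂′ _ eq₂)))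
                (↭⇒≈ (↭-sym (trees-perm S₁ S₂ p₁′ p₂′ ts′ as′ arranged′)))))

    injectives : ∀ ts as → All IsInjective (strees ts as)
    injectives [] [] = []
    injectives (t ∷ ts) (a ∷ as) = injective t a ∷ injectives ts as

  ≈T-common-edge : ∀ {H H′ : Sub E} {t t′} → IsConstruct G H t → IsConstruct G H′ t′ → t ≈T t′ →
                   Σ E λ e → e ∈ₛ H × e ∈ₛ H′
  ≈T-common-edge ic ic′ (node≈ Y≐ _) with root-info ic | root-info ic′
    where
    root-info : ∀ {H Y ts} → IsConstruct G H (node Y ts) → NonEmpty Y × Y ⊆ₛ H
    root-info (top ne Y≐H) = ne , λ e e∈ → trans (sym (Y≐H e)) e∈
    root-info (step _ ne Y⊆ _ _ _) = ne , Y⊆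
  ... | (e , e∈Y) , Y⊆H | _ , Y′⊆H′ = e , Y⊆H e e∈Y , Y′⊆H′ e (trans (sym (Y≐ e)) e∈Y)

  items-apart : ∀ {Q Q′} {Sa Sb : RTree A} → (∀ {z} → z ∈ labels Sa → z ∈ labels Sb → ⊥) →
                (i : Item Q Sa) (j : Item Q′ Sb) → tree i ≈T tree j → ⊥
  items-apart apart i j i≈j with ≈T-common-edge (constr i) (constr j) i≈j
  ... | e , e∈i , e∈j = apart (proj₁ (childOf-labels (edge-of (piece i) e e∈i)))
                              (proj₁ (childOf-labels (edge-of (piece j) e e∈j)))

  part-member : ∀ {Q} (S′ : RTree A) (p : Part Q S′) (d : Word A) {y} → y ∈ map proj₁ (partTrees S′ p) →
    Σ (Item Q S′) λ i → tree i ≡ y × partWord S′ p d ≡ proj₁ (word′ (stree i))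
  part-member (nd a (_ ∷ _)) i d (here refl) = i , refl , refl

  IsRespectful : STree → Set
  IsRespectful (t , a) = ∀ {S σ σ′} → Piece S σ → Piece S σ′ → IsConstruct G σ t →
    ∀ t′ a′ → IsConstruct G σ′ t′ → t ≈T t′ → proj₁ (word t a) ≡ proj₁ (word t′ a′)

  -- The part on side Sj is matched, child by child, with the part on the same side
  -- (never the other side Sk, which has no node in common with Sj).
  respects-part : ∀ {Sj Sk : RTree A} → (∀ {z} → z ∈ labels Sj → z ∈ labels Sk → ⊥) →
    (pj : Part IsRespectful Sj) (pj′ : Part NoHyp Sj) (pk′ : Part NoHyp Sk) (d : Word A) →
    (∀ {t} → t ∈ map proj₁ (partTrees Sj pj) → Σ (CTree E) λ y → t ≈T y ×
               (y ∈ map proj₁ (partTrees Sj pj′) ⊎ y ∈ map proj₁ (partTrees Sk pk′))) →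
    partWord Sj pj d ≡ partWord Sj pj′ d
  respects-part {nd a []} apart _ _ _ _ _ = refl
  respects-part {nd a (_ ∷ _)} {Sk} apart i pj′ pk′ d counterpart with counterpart (here refl)
  ... | y , i≈y , inj₁ y∈ with part-member (nd a (_ ∷ _)) pj′ d y∈
  ...   | i′ , refl , word≡ =
          trans (ih i (piece i) (piece i′) (constr i) (tree i′) (singles i′) (constr i′) i≈y) (sym word≡)
  respects-part {nd a (_ ∷ _)} {Sk} apart i pj′ pk′ d counterpart
      | y , i≈y , inj₂ y∈ with part-member Sk pk′ d y∈
  ...   | k′ , refl , _ = ⊥-elim (items-apart apart i k′ i≈y)

  mutual
    respects : ∀ t a → IsRespectful (t , a)
    respects (node Y ts) (node (x , Y≡) as) pc pc′ ic (node Y′ ts′) (node (x′ , Y′≡) as′) ic′ (node≈ Y≐ perm)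
      with proj₁ (Y′≡ x) (trans (sym (Y≐ x)) (proj₂ (Y≡ x) refl))
    ... | refl with edge→split (edge-of pc x (root∈ ic Y≡))
    ... | S₁ , S₂ , sp , x-parent , x-child
      with Decompose.decompose pc sp x x-parent x-child Y Y≡ items-admissible items-admissible
                               ts as ic (respectfuls ts as)
         | Decompose.decompose pc′ sp x x-parent x-child Y′ Y′≡ items-admissible items-admissible
                               ts′ as′ ic′ (all-trivial _)
    ... | p₁ , p₂ , arranged , word≡ | p₁′ , p₂′ , arranged′ , word≡′ =
      trans word≡ (trans (cong₂ ⟨_·_⟩
        (respects-part apart p₁ p₁′ p₂′ _ λ m → counterpart (∈-++⁺ˡ m))
        (respects-part (λ m₂ m₁ → apart m₁ m₂) p₂ p₂′ p₁′ _
                       λ m → Data.Product.map₂ (Data.Product.map₂ Data.Sum.swap) (counterpart (∈-++⁺ʳ _ m))))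
        (sym word≡′))
      where
      open Deletion pc sp x x-parent x-child Y Y≡ using (apart)
      counterpart : ∀ {t} → t ∈ map proj₁ (partTrees S₁ p₁) ++ map proj₁ (partTrees S₂ p₂) →
        Σ (CTree E) λ y → t ≈T y × (y ∈ map proj₁ (partTrees S₁ p₁′) ⊎ y ∈ map proj₁ (partTrees S₂ p₂′))
      counterpart m with related-member ≈T-trans perm
                           (↭.∈-resp-↭ (↭-sym (trees-perm S₁ S₂ p₁ p₂ ts as arranged)) m)
      ... | y , y∈ , t≈y =
        y , t≈y , ∈-++⁻ _ (↭.∈-resp-↭ (trees-perm S₁ S₂ p₁′ p₂′ ts′ as′ arranged′) y∈)

    respectfuls : ∀ ts as → All IsRespectful (strees ts as)
    respectfuls [] [] = []
    respectfuls (t ∷ ts) (a ∷ as) = respects t a ∷ respectfuls ts as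

root-edge : ∀ {A : Set} (T : RTree A) → children T ≢ [] → Σ A λ v → ChildOf T (rootLabel T) v
root-edge (nd a []) no-children = ⊥-elim (no-children refl)
root-edge (nd a (t ∷ ts)) _ = rootLabel t , direct (here refl)

proposition4 : {A : Set} (T : RTree A) → Unique (labels T) → children T ≢ [] →
    BijectionOnto {Construction T} {Word A} _≈C_ (λ w → Admissible w T)
proposition4 T U has-children = record
  { f         = λ (t , _ , a) → proj₁ (word t a)
  ; into      = λ (t , ic , a) → admissible t a whole ic
  ; respects  = λ (t , ic , a) (t′ , ic′ , a′) → respects t a whole whole ic t′ a′ ic′
  ; injective = λ (t , ic , a) (t′ , ic′ , a′) → injective t a whole whole ic t′ a′ ic′
  ; onto      = λ w adm → let (t , ic , a , t↦w) = surjective whole (proj₂ (root-edge T has-children)) adm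
                          in (t , ic , a) , t↦w
  }
  where
  open Main T U
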